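{- Let $M_T$ be a tree-growing map in which the endpoint of every leg is an ancestor of the head-vertex. Suppose that the first and last legs exist and have distinct endpoints; call these endpoints $u$ and $v$, with $u$ an ancestor of $v$. Then $v$ is the last vertex incident to a leg other than the head on the $T$-path from the root-vertex to the head-vertex.
   Context: A planar map is a connected planar graph (loops, multiple edges allowed) embedded in the sphere up to orientation-preserving homeomorphism; edges consist of two half-edges. A rooted map has a distinguished half-edge (the root), whose endpoint is the root-vertex. A growing map is a rooted map together with some legs (half-edges not belonging to a complete edge), one leg being distinguished as the head, all legs lying in one face, the head-face; the endpoint of the head is the head-vertex. A tree-growing map $M_T$ is a growing map with a distinguished spanning tree $T$. $u$ is an ancestor of $v$ if $u$ lies on the path in $T$ from the root-vertex to $v$. The tour of the head-face follows its border counterclockwise (face on the left) starting from the head; it linearly orders the legs other than the head, and the first and last legs are the first and last in this order. -}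

module Defs where

open import Data.Nat using (ℕ; zero; suc; _+_; _*_; _≤_; _<_; _≤ᵇ_)
open import Data.Unit using (⊤)
open import Data.Bool using (Bool; true; false; if_then_else_)
open import Data.Fin using (Fin; zero; suc; _≟_; toℕ)
open import Data.Fin.Permutation using (Permutation′; _⟨$⟩ʳ_; _⟨$⟩ˡ_)
open import Data.List using (List; []; _∷_)
open import Data.List.Membership.Propositional using (_∈_)
open import Data.List.Relation.Unary.Unique.Propositional using (Unique)
open import Data.Product using (Σ; ∃; _×_; _,_)
open import Data.Sum using (_⊎_)
open import Relation.Binary.PropositionalEquality using (_≡_; _≢_)
open import Relation.Nullary using (¬_)
open import Relation.Nullary.Decidable using (⌊_⌋)

iter : ∀ {A : Set} → (A → A) → ℕ → A → A
iter f zero    x = x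
iter f (suc k) x = f (iter f k x)

countF : ∀ {n} → (Fin n → Bool) → ℕ
countF {zero}  p = 0
countF {suc n} p = (if p zero then 1 else 0) + countF (λ i → p (suc i))

-- Half-edges (including legs) are Fin n.  σ is the counterclockwise
-- rotation of half-edges around their endpoint; α is the involution
-- pairing the two half-edges of a complete edge, and legs are exactly
-- the fixed points of α.  Vertices are Fin V, `vert h` is the endpoint
-- of h, and the fibres of `vert` are exactly the σ-orbits.  The face
-- permutation (border followed counterclockwise, i.e. face on the left)
-- is φ = σ⁻¹ ∘ α; faces are Fin F, and the fibres of `face` are exactly
-- the φ-orbits.  A leg lies in the face containing it in its φ-orbit.

record PreMap : Set where
  field
    n V F : ℕ
    σ α   : Permutation′ n
    vert  : Fin n → Fin V
    face  : Fin n → Fin F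

  φ : Fin n → Fin n
  φ h = σ ⟨$⟩ˡ (α ⟨$⟩ʳ h)

  Leg : Fin n → Set
  Leg h = α ⟨$⟩ʳ h ≡ h

  NotLeg : Fin n → Set
  NotLeg h = α ⟨$⟩ʳ h ≢ h

  numLegs : ℕ
  numLegs = countF (λ h → ⌊ α ⟨$⟩ʳ h ≟ h ⌋)

  -- Walks in the subgraph formed by the complete edges whose half-edges
  -- satisfy P: a list of half-edges h₁ … h_k, each traversed from its
  -- endpoint to the endpoint of its partner α hᵢ.
  data Walk (P : Fin n → Set) : Fin V → List (Fin n) → Fin V → Set where
    nil  : ∀ {x} → Walk P x [] x
    cons : ∀ {x h hs y} → P h → NotLeg h → vert h ≡ x →
           Walk P (vert (α ⟨$⟩ʳ h)) hs y → Walk P x (h ∷ hs) y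

  visited : Fin V → List (Fin n) → List (Fin V)
  visited x []       = x ∷ []
  visited x (h ∷ hs) = x ∷ visited (vert (α ⟨$⟩ʳ h)) hs

  -- canonical name of the (complete) edge containing h
  edgeOf : Fin n → Fin n
  edgeOf h = if toℕ h ≤ᵇ toℕ (α ⟨$⟩ʳ h)
             then h else α ⟨$⟩ʳ h

  edgesOf : List (Fin n) → List (Fin n)
  edgesOf []       = []
  edgesOf (h ∷ hs) = edgeOf h ∷ edgesOf hs

  -- P-subgraph contains a cycle: a closed walk with at least one edge
  -- and no repeated edge (a loop edge is such a cycle)
  HasCycle : (Fin n → Set) → Set
  HasCycle P = Σ (Fin V) λ x → Σ (Fin n) λ h → Σ (List (Fin n)) λ hs →
               Walk P x (h ∷ hs) x × Unique (edgesOf (h ∷ hs))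

record GrowingMap : Set where
  field
    pre : PreMap
  open PreMap pre public
  field
    α-invol    : ∀ h → α ⟨$⟩ʳ (α ⟨$⟩ʳ h) ≡ h
    vert-orbit : ∀ h h' → vert h ≡ vert h' → ∃ λ k → iter (σ ⟨$⟩ʳ_) k h ≡ h'
    orbit-vert : ∀ h h' k → iter (σ ⟨$⟩ʳ_) k h ≡ h' → vert h ≡ vert h'
    vert-surj  : ∀ x → ∃ λ h → vert h ≡ x
    face-orbit : ∀ h h' → face h ≡ face h' → ∃ λ k → iter φ k h ≡ h'
    orbit-face : ∀ h h' k → iter φ k h ≡ h' → face h ≡ face h'
    face-surj  : ∀ f → ∃ λ h → face h ≡ f
    root        : Fin n
    root-notLeg : NotLeg root
    connected  : ∀ x → ∃ λ hs → Walk (λ _ → ⊤) (vert root) hs x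
    -- planarity (genus 0): V - E + F = 2 where E = (n - #legs)/2
    planar     : 2 * V + 2 * F + numLegs ≡ n + 4
    head       : Fin n
    head-leg   : Leg head
    legs-in-head-face : ∀ l → Leg l → face l ≡ face head

record TreeGrowingMap : Set₁ where
  field
    gm : GrowingMap
  open GrowingMap gm public
  field
    T        : Fin n → Set
    T-notLeg : ∀ h → T h → NotLeg h
    T-sym    : ∀ h → T h → T (α ⟨$⟩ʳ h)
    T-spans  : ∀ x → ∃ λ hs → Walk T (vert root) hs x
    T-acyclic : ¬ HasCycle T

  rootVertex : Fin V
  rootVertex = vert root

  headVertex : Fin V
  headVertex = vert head

  -- u lies on the (unique) path in T from the root-vertex to w
  Ancestor : Fin V → Fin V → Set
  Ancestor u w = Σ (List (Fin n)) λ hs →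
    Walk T rootVertex hs w × Unique (visited rootVertex hs) × u ∈ visited rootVertex hs

  -- k > 0 is the position of half-edge l in the tour of the head-face
  -- starting from the head (first time l is reached following φ)
  TourIndex : Fin n → ℕ → Set
  TourIndex l k = 0 < k × iter φ k head ≡ l ×
                  (∀ m → 0 < m → m < k → iter φ m head ≢ l)

  OtherLeg : Fin n → Set
  OtherLeg l = Leg l × l ≢ head

  IsFirstLeg : Fin n → Set
  IsFirstLeg f = OtherLeg f × Σ ℕ λ i → TourIndex f i ×
                 (∀ l j → OtherLeg l → TourIndex l j → i ≤ j)

  IsLastLeg : Fin n → Set
  IsLastLeg g = OtherLeg g × Σ ℕ λ i → TourIndex g i ×
                (∀ l j → OtherLeg l → TourIndex l j → j ≤ i)

-- Join the first leg f and the last leg g by a new edge across the head-face. The spanning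
-- tree T has a single face, so T plus the new edge is a unicycle U with two faces, separated by the
-- cycle formed by the new edge and the tree path between u and v. Counting faces while adding the
-- remaining edges one at a time (each changes the number of faces by exactly one) and comparing with
-- Euler's formula shows that each of them splits a face, so faces of the whole map with the new edge
-- refine those of U. Since the tour meets f, then any other leg l, then g, the head shares a face with f
-- and l shares one with g. If l hung off a vertex w outside the path from the root to v, then w lies
-- below v, and the tree edge d leaving v towards the head-vertex separates u and v from the head-vertex
-- and from w. Face boundaries of U only pass between the two sides through d or its opposite half-edge,
-- so the arcs of the face of f from the head to f and back use both of them, and the face of g, running
-- through d towards l, must be the face of f: a contradiction.

module Submission where

open import Defs
open import Data.Bool using (Bool; true; false; if_then_else_; _∧_; _∨_; not)
open import Data.Bool.Properties using (∧-zeroʳ; ∧-identityʳ; ∨-zeroʳ; ∨-identityʳ)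
open import Data.Empty using (⊥; ⊥-elim)
open import Data.Fin using (Fin; zero; suc; toℕ; fromℕ<; _≟_)
import Data.Fin.Properties as Fin
open import Data.Fin.Permutation using (_⟨$⟩ʳ_; _⟨$⟩ˡ_; inverseʳ; inverseˡ)
open import Data.Fin.Permutation.Components using (transpose)
open import Data.List using (List; []; _∷_; _++_)
open import Data.List.Membership.Propositional using (_∈_; _∉_)
open import Data.List.Membership.Propositional.Properties using (∈-++⁺ˡ; ∈-++⁺ʳ; ∈-++⁻)
open import Data.List.Relation.Unary.Any using (here; there)
open import Data.List.Relation.Unary.All using (All; []; _∷_)
import Data.List.Relation.Unary.All.Properties as All
open import Data.List.Relation.Unary.AllPairs using ([]; _∷_)
open import Data.List.Relation.Unary.Unique.Propositional using (Unique)
open import Data.Nat using (ℕ; zero; suc; _+_; _*_; _∸_; _≤_; _<_; _≤?_; _≤ᵇ_; z≤n; s≤s; s≤s⁻¹)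
open import Data.Nat.Properties hiding (_≟_)
open import Data.Nat.DivMod using (_%_; _/_; m≡m%n+[m/n]*n; m%n<n)
open import Data.Nat.Solver using (module +-*-Solver)
open import Data.Product using (Σ; ∃; _×_; _,_; proj₁; proj₂)
open import Data.Sum using (_⊎_; inj₁; inj₂; [_,_]′)
open import Function using (_∘_; case_of_)
open import Function.Bundles using (mk⇔)
open import Function.Definitions using (Injective)
open import Relation.Binary.Definitions using (tri<; tri≈; tri>)
open import Relation.Binary.PropositionalEquality
open import Relation.Nullary using (¬_; Dec; yes; no; does; proof; contradiction)
open import Relation.Nullary.Decidable using (⌊_⌋; isYes≗does; dec-true; dec-false; does-⇔; ¬¬-excluded-middle)
open import Relation.Nullary.Reflects using (Reflects; invert)

infixl 6 _∖_

_∖_ : ∀ {n} → (Fin n → Bool) → (Fin n → Bool) → Fin n → Bool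
(p ∖ q) h = p h ∧ not (q h)

∖-left : ∀ {n} {h : Fin n} (p q : Fin n → Bool) → (p ∖ q) h ≡ true → p h ≡ true
∖-left {h = h} p q _ with p h
... | true = refl

∖-right : ∀ {n} {h : Fin n} (p q : Fin n → Bool) → (p ∖ q) h ≡ true → q h ≡ false
∖-right {h = h} p q _ with p h | q h
... | true | false = refl

∖-false : ∀ {n} {h : Fin n} (p q : Fin n → Bool) →
          (q h ≡ true → p h ≡ true) → (p ∖ q) h ≡ false → p h ≡ q h
∖-false {h = h} p q q⊆p old with q h | p h
... | true  | _  = q⊆p refl
... | false | ph = trans (sym (∧-identityʳ ph)) old

erase : ∀ {n} → Fin n → (Fin n → Bool) → Fin n → Bool
erase z p = p ∖ λ h → does (h ≟ z)

erase-⊆ : ∀ {n} {z h : Fin n} (p : Fin n → Bool) → erase z p h ≡ true → p h ≡ true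
erase-⊆ {z = z} p = ∖-left p (λ h → does (h ≟ z))

erase-≡ : ∀ {n} (z : Fin n) (p : Fin n → Bool) → erase z p z ≡ false
erase-≡ z p rewrite dec-true (z ≟ z) refl = ∧-zeroʳ (p z)

erase-≢ : ∀ {n} {z h : Fin n} (p : Fin n → Bool) → h ≢ z → erase z p h ≡ p h
erase-≢ {z = z} {h} p h≢z rewrite dec-false (h ≟ z) h≢z = ∧-identityʳ (p h)

erase-false : ∀ {n} {z h : Fin n} (p : Fin n → Bool) → p h ≡ false → erase z p h ≡ false
erase-false p ph rewrite ph = refl

insert : ∀ {n} → Fin n → (Fin n → Bool) → Fin n → Bool
insert z p h = p h ∨ does (h ≟ z)

insert-≡ : ∀ {n} (z : Fin n) (p : Fin n → Bool) → insert z p z ≡ true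
insert-≡ z p rewrite dec-true (z ≟ z) refl = ∨-zeroʳ (p z)

insert-≢ : ∀ {n} {z h : Fin n} (p : Fin n → Bool) → h ≢ z → insert z p h ≡ p h
insert-≢ {z = z} {h} p h≢z rewrite dec-false (h ≟ z) h≢z = ∨-identityʳ (p h)

countF-cong : ∀ {n} {p q : Fin n → Bool} → (∀ h → p h ≡ q h) → countF p ≡ countF q
countF-cong {zero}  p≗q = refl
countF-cong {suc n} p≗q =
  cong₂ _+_ (cong (λ b → if b then 1 else 0) (p≗q zero)) (countF-cong (p≗q ∘ suc))

countF-true : ∀ n → countF {n} (λ _ → true) ≡ n
countF-true zero    = refl
countF-true (suc n) = cong suc (countF-true n)

countF-flip : ∀ {n} {p q : Fin n → Bool} (z : Fin n) → p z ≡ false → q z ≡ true →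
              (∀ h → h ≢ z → p h ≡ q h) → countF q ≡ suc (countF p)
countF-flip {p = p} {q} zero pz qz p≗q rewrite pz | qz =
  cong suc (countF-cong (λ h → sym (p≗q (suc h) λ ())))
countF-flip {p = p} {q} (suc z) pz qz p≗q rewrite p≗q zero (λ ()) with q zero
... | true  = cong suc (countF-flip z pz qz (λ h h≢z → p≗q (suc h) (h≢z ∘ Fin.suc-injective)))
... | false = countF-flip z pz qz (λ h h≢z → p≗q (suc h) (h≢z ∘ Fin.suc-injective))

countF-erase : ∀ {n} {p : Fin n → Bool} (z : Fin n) → p z ≡ true → countF p ≡ suc (countF (erase z p))
countF-erase {p = p} z pz = countF-flip z (erase-≡ z p) pz (λ h h≢z → erase-≢ p h≢z)

countF-insert : ∀ {n} {p : Fin n → Bool} (z : Fin n) → p z ≡ false → countF (insert z p) ≡ suc (countF p)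
countF-insert {p = p} z pz = countF-flip z pz (insert-≡ z p) (λ h h≢z → sym (insert-≢ p h≢z))

countF-≡0 : ∀ {n} {p : Fin n → Bool} → countF p ≡ 0 → ∀ h → p h ≡ false
countF-≡0 {suc n} {p} none h with p zero in p0
countF-≡0 {suc n} {p} none zero    | false = p0
countF-≡0 {suc n} {p} none (suc h) | false = countF-≡0 none h

countF-witness : ∀ {n} {p : Fin n → Bool} → 0 < countF p → ∃ λ h → p h ≡ true
countF-witness {suc n} {p} some with p zero in p0
... | true  = zero , p0
... | false with countF-witness some
...   | h , ph = suc h , ph

countF-∖ : ∀ {n} {p q : Fin n → Bool} → (∀ h → q h ≡ true → p h ≡ true) →
           countF (p ∖ q) + countF q ≡ countF p
countF-∖ {zero}  q⊆p = refl
countF-∖ {suc n} {p} {q} q⊆p with countF-∖ (q⊆p ∘ suc) | p zero in p0 | q zero in q0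
... | ih | true  | true  = trans (+-suc _ _) (cong suc ih)
... | ih | true  | false = cong suc ih
... | ih | false | false = ih
... | ih | false | true  with () ← trans (sym (q⊆p zero q0)) p0

select : ∀ {n} (p : Fin n → Bool) → Fin (countF p) → Fin n
select {suc n} p i with p zero
select {suc n} p zero    | true  = zero
select {suc n} p (suc i) | true  = suc (select (p ∘ suc) i)
select {suc n} p i       | false = suc (select (p ∘ suc) i)

select-true : ∀ {n} (p : Fin n → Bool) (i : Fin (countF p)) → p (select p i) ≡ true
select-true {suc n} p i with p zero in p0
select-true {suc n} p zero    | true  = p0
select-true {suc n} p (suc i) | true  = select-true (p ∘ suc) i
select-true {suc n} p i       | false = select-true (p ∘ suc) i

select-injective : ∀ {n} (p : Fin n → Bool) → Injective _≡_ _≡_ (select p)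
select-injective {suc n} p {i} {j} eq with p zero
select-injective {suc n} p {zero}  {zero}  eq | true  = refl
select-injective {suc n} p {suc i} {suc j} eq | true  =
  cong suc (select-injective (p ∘ suc) (Fin.suc-injective eq))
select-injective {suc n} p {i}     {j}     eq | false = select-injective (p ∘ suc) (Fin.suc-injective eq)

rank : ∀ {n} (p : Fin n → Bool) (h : Fin n) → p h ≡ true → Fin (countF p)
rank {suc n} p zero ph with p zero
... | true  = zero
... | false with () ← ph
rank {suc n} p (suc h) ph with p zero
... | true  = suc (rank (p ∘ suc) h ph)
... | false = rank (p ∘ suc) h ph

rank-injective : ∀ {n} (p : Fin n → Bool) {h h′ : Fin n} (ph : p h ≡ true) (ph′ : p h′ ≡ true) →
                 rank p h ph ≡ rank p h′ ph′ → h ≡ h′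
rank-injective {suc n} p {zero}  {zero}   ph ph′ eq = refl
rank-injective {suc n} p {zero}  {suc h′} ph ph′ eq with p zero
... | true  with () ← eq
... | false with () ← ph
rank-injective {suc n} p {suc h} {zero}   ph ph′ eq with p zero
... | true  with () ← eq
... | false with () ← ph′
rank-injective {suc n} p {suc h} {suc h′} ph ph′ eq with p zero
... | true  = cong suc (rank-injective (p ∘ suc) ph ph′ (Fin.suc-injective eq))
... | false = cong suc (rank-injective (p ∘ suc) ph ph′ eq)

countF-≤1 : ∀ {n} {p : Fin n → Bool} → (∀ h h′ → p h ≡ true → p h′ ≡ true → h ≡ h′) → countF p ≤ 1
countF-≤1 {p = p} unique = Fin.injective⇒≤ {f = λ (_ : Fin (countF p)) → zero {0}}
  (λ {i} {j} _ → select-injective p (unique _ _ (select-true p i) (select-true p j)))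

countF-≡ : ∀ {n m} {p : Fin n → Bool} (c : Fin n → Fin m) →
           (∀ h h′ → p h ≡ true → p h′ ≡ true → c h ≡ c h′ → h ≡ h′) →
           (∀ j → ∃ λ h → p h ≡ true × c h ≡ j) → countF p ≡ m
countF-≡ {m = m} {p = p} c c-injective c-surjective =
  ≤-antisym (Fin.injective⇒≤ {f = c ∘ select p} c∘select-injective)
            (Fin.injective⇒≤ {f = rank∘preimage} rank∘preimage-injective)
  where
  c∘select-injective : Injective _≡_ _≡_ (c ∘ select p)
  c∘select-injective {i} {j} eq = select-injective p (c-injective _ _ (select-true p i) (select-true p j) eq)
  rank∘preimage : Fin m → Fin (countF p)
  rank∘preimage j with c-surjective j
  ... | h , ph , _ = rank p h ph
  rank∘preimage-injective : Injective _≡_ _≡_ rank∘preimage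
  rank∘preimage-injective {i} {j} eq with c-surjective i | c-surjective j
  ... | h , ph , refl | h′ , ph′ , refl = cong c (rank-injective p ph ph′ eq)

private
  variable
    A : Set

module _ (f : A → A) where

  iter-+ : ∀ j k x → iter f (j + k) x ≡ iter f j (iter f k x)
  iter-+ zero    k x = refl
  iter-+ (suc j) k x = cong f (iter-+ j k x)

  iter-suc : ∀ k x → iter f (suc k) x ≡ iter f k (f x)
  iter-suc k x = trans (cong (λ m → iter f m x) (+-comm 1 k)) (iter-+ k 1 x)

  iter-comm : ∀ j k x → iter f j (iter f k x) ≡ iter f k (iter f j x)
  iter-comm j k x = trans (sym (iter-+ j k x)) (trans (cong (λ m → iter f m x) (+-comm j k)) (iter-+ k j x))

  iter-* : ∀ p x → iter f p x ≡ x → ∀ m → iter f (m * p) x ≡ x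
  iter-* p x fixed zero    = refl
  iter-* p x fixed (suc m) = trans (iter-+ p (m * p) x) (trans (cong (iter f p) (iter-* p x fixed m)) fixed)

iter-cong : {f g : A → A} → (∀ x → f x ≡ g x) → ∀ k x → iter f k x ≡ iter g k x
iter-cong         f≗g zero    x = refl
iter-cong {f = f} f≗g (suc k) x = trans (cong f (iter-cong f≗g k x)) (f≗g _)

least-below : (P : ℕ → Set) → (∀ k → Dec (P k)) → ∀ m →
              (∃ λ j → j < m × P j × (∀ i → i < j → ¬ P i)) ⊎ (∀ j → j < m → ¬ P j)
least-below P P? zero = inj₂ λ _ ()
least-below P P? (suc m) with least-below P P? m
... | inj₁ (j , j<m , pj , minimal) = inj₁ (j , m<n⇒m<1+n j<m , pj , minimal)
... | inj₂ none with P? m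
...   | yes pm = inj₁ (m , ≤-refl , pm , none)
...   | no ¬pm = inj₂ λ j j<1+m → case m≤n⇒m<n∨m≡n (s≤s⁻¹ j<1+m) of λ where
          (inj₁ j<m)  → none j j<m
          (inj₂ refl) → ¬pm

least : (P : ℕ → Set) → (∀ k → Dec (P k)) → ∀ k → P k → ∃ λ j → P j × (∀ i → i < j → ¬ P i)
least P P? k pk with least-below P P? k
... | inj₁ (j , _ , pj , minimal) = j , pj , minimal
... | inj₂ none                   = k , pk , none

least-element : ∀ {n} (Q : Fin n → Set) → (∀ y → Dec (Q y)) → ∀ {y} → Q y →
                ∃ λ m → Q m × (∀ {z} → Q z → toℕ m ≤ toℕ z)
least-element {suc n} Q Q? {y} qy with Q? zero
... | yes q0 = zero , q0 , λ _ → z≤n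
least-element {suc n} Q Q? {zero}  qy | no ¬q0 = ⊥-elim (¬q0 qy)
least-element {suc n} Q Q? {suc y} qy | no ¬q0 with least-element (Q ∘ suc) (Q? ∘ suc) qy
... | m , qm , minimal = suc m , qm , below
  where
  below : ∀ {z} → Q z → toℕ (suc m) ≤ toℕ z
  below {zero}  qz = ⊥-elim (¬q0 qz)
  below {suc z} qz = s≤s (minimal qz)

module Orbits {n : ℕ} (π : Fin n → Fin n) where

  infix 4 _↝_

  _↝_ : Fin n → Fin n → Set
  x ↝ y = ∃ λ k → iter π k x ≡ y

  ↝-refl : ∀ {x} → x ↝ x
  ↝-refl = 0 , refl

  ↝-step : ∀ x → x ↝ π x
  ↝-step x = 1 , refl

  ↝-trans : ∀ {x y z} → x ↝ y → y ↝ z → x ↝ z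
  ↝-trans {x} (j , refl) (k , refl) = k + j , iter-+ π k j x

  Leads : Fin n → Set
  Leads x = ∀ (k : Fin n) → toℕ x ≤ toℕ (iter π (toℕ k) x)

  leads? : ∀ x → Dec (Leads x)
  leads? x = Fin.all? λ k → toℕ x ≤? toℕ (iter π (toℕ k) x)

  isLeader : Fin n → Bool
  isLeader x = does (leads? x)

  cycles : ℕ
  cycles = countF isLeader

isLeader-cong : ∀ {n} {π ρ : Fin n → Fin n} {x} → (∀ k → iter π k x ≡ iter ρ k x) →
                Orbits.isLeader π x ≡ Orbits.isLeader ρ x
isLeader-cong {π = π} {ρ} {x} same-orbit =
  does-⇔ (mk⇔ (λ leads k → subst (toℕ x ≤_) (cong toℕ (same-orbit (toℕ k))) (leads k))
              (λ leads k → subst (toℕ x ≤_) (cong toℕ (sym (same-orbit (toℕ k)))) (leads k)))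
         (Orbits.leads? π x) (Orbits.leads? ρ x)

cycles-cong : ∀ {n} {π ρ : Fin n → Fin n} → (∀ x → π x ≡ ρ x) → Orbits.cycles π ≡ Orbits.cycles ρ
cycles-cong π≗ρ = countF-cong λ x → isLeader-cong λ k → iter-cong π≗ρ k x

module Cycles {n : ℕ} (π : Fin n → Fin n) (π-injective : Injective _≡_ _≡_ π) where

  open Orbits π public

  iter-injective : ∀ k {x y} → iter π k x ≡ iter π k y → x ≡ y
  iter-injective zero    eq = eq
  iter-injective (suc k) eq = iter-injective k (π-injective eq)

  period : ∀ x → ∃ λ p → 0 < p × p ≤ n × iter π p x ≡ x
  period x with Fin.pigeonhole ≤-refl (λ (i : Fin (suc n)) → iter π (toℕ i) x)
  ... | i , j , i<j , eq = toℕ j ∸ toℕ i , m<n⇒0<n∸m i<j , d≤n , sym (iter-injective (toℕ i) returns)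
    where
    d≤n : toℕ j ∸ toℕ i ≤ n
    d≤n = ≤-trans (m∸n≤m (toℕ j) (toℕ i)) (s≤s⁻¹ (Fin.toℕ<n j))
    returns : iter π (toℕ i) x ≡ iter π (toℕ i) (iter π (toℕ j ∸ toℕ i) x)
    returns = begin
      iter π (toℕ i) x                          ≡⟨ eq ⟩
      iter π (toℕ j) x                          ≡⟨ cong (λ m → iter π m x) (sym (m+[n∸m]≡n (<⇒≤ i<j))) ⟩
      iter π (toℕ i + (toℕ j ∸ toℕ i)) x        ≡⟨ iter-+ π (toℕ i) _ x ⟩
      iter π (toℕ i) (iter π (toℕ j ∸ toℕ i) x) ∎
      where open ≡-Reasoning

  ↝-back : ∀ x → π x ↝ x
  ↝-back x with period x
  ... | suc p , _ , _ , returns = p , trans (sym (iter-suc π p x)) returns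

  ↝-sym : ∀ {x y} → x ↝ y → y ↝ x
  ↝-sym {x} (zero  , refl) = ↝-refl
  ↝-sym {x} (suc k , refl) = ↝-trans (↝-back (iter π k x)) (↝-sym (k , refl))

  ↝-bounded : ∀ {x y} → x ↝ y → ∃ λ k → k < n × iter π k x ≡ y
  ↝-bounded {x} (k , refl) with period x
  ... | suc p , _ , p≤n , returns = k % suc p , ≤-trans (m%n<n k (suc p)) p≤n , sym reduce
    where
    reduce : iter π k x ≡ iter π (k % suc p) x
    reduce = trans (cong (λ m → iter π m x) (m≡m%n+[m/n]*n k (suc p)))
                   (trans (iter-+ π (k % suc p) _ x)
                          (cong (iter π (k % suc p)) (iter-* π (suc p) x returns (k / suc p))))

  _↝?_ : ∀ x y → Dec (x ↝ y)
  x ↝? y with least-below (λ k → iter π k x ≡ y) (λ k → iter π k x ≟ y) n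
  ... | inj₁ (k , _ , reach , _) = yes (k , reach)
  ... | inj₂ none                = no λ r → let (k , k<n , reach) = ↝-bounded r in none k k<n reach

  first-arrival : ∀ {x y} → x ↝ y → ∃ λ k → iter π k x ≡ y × (∀ i → i < k → iter π i x ≢ y)
  first-arrival {x} {y} (k , reach) = least (λ k → iter π k x ≡ y) (λ k → iter π k x ≟ y) k reach

  first-return : ∀ x → ∃ λ p → iter π (suc p) x ≡ x × (∀ i → i < p → iter π (suc i) x ≢ x)
  first-return x with period x
  ... | suc p , _ , _ , returns = least (λ k → iter π (suc k) x ≡ x) (λ k → iter π (suc k) x ≟ x) p returns

  leader⇒≤ : ∀ {x} → isLeader x ≡ true → ∀ {y} → x ↝ y → toℕ x ≤ toℕ y
  leader⇒≤ {x} leader r with ↝-bounded r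
  ... | k , k<n , refl = subst (λ m → toℕ x ≤ toℕ (iter π m x)) (Fin.toℕ-fromℕ< k<n) (leads (fromℕ< k<n))
    where
    leads : Leads x
    leads = invert (subst (Reflects (Leads x)) leader (proof (leads? x)))

  ≤⇒leader : ∀ {x} → (∀ {y} → x ↝ y → toℕ x ≤ toℕ y) → isLeader x ≡ true
  ≤⇒leader {x} minimal = dec-true (leads? x) λ k → minimal (toℕ k , refl)

  ≰⇒¬leader : ∀ {x y} → x ↝ y → toℕ y < toℕ x → isLeader x ≡ false
  ≰⇒¬leader {x} r y<x = dec-false (leads? x) λ leads → <⇒≱ y<x (leader⇒≤ (dec-true (leads? x) leads) r)

  leader-unique : ∀ {x y} → isLeader x ≡ true → isLeader y ≡ true → x ↝ y → x ≡ y
  leader-unique x-leads y-leads r =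
    Fin.toℕ-injective (≤-antisym (leader⇒≤ x-leads r) (leader⇒≤ y-leads (↝-sym r)))

  leader-of : ∀ x → ∃ λ l → x ↝ l × isLeader l ≡ true
  leader-of x with least-element (x ↝_) (x ↝?_) ↝-refl
  ... | l , x↝l , minimal = l , x↝l , ≤⇒leader λ l↝y → minimal (↝-trans x↝l l↝y)

  cycles-≡ : ∀ {m} (c : Fin n → Fin m) → (∀ {x y} → c x ≡ c y → x ↝ y) → (∀ {x y} → x ↝ y → c x ≡ c y) →
             (∀ j → ∃ λ x → c x ≡ j) → cycles ≡ m
  cycles-≡ c c⇒↝ ↝⇒c c-surjective = countF-≡ c (λ _ _ lx ly eq → leader-unique lx ly (c⇒↝ eq)) leader-above
    where
    leader-above : ∀ j → ∃ λ l → isLeader l ≡ true × c l ≡ j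
    leader-above j with c-surjective j
    ... | x , refl with leader-of x
    ...   | l , x↝l , leads = l , leads , sym (↝⇒c x↝l)

  cycles-≤1 : ∀ x → (∀ y → x ↝ y) → cycles ≤ 1
  cycles-≤1 x x↝ = countF-≤1 λ y z ly lz → leader-unique ly lz (↝-trans (↝-sym (x↝ y)) (x↝ z))

  arcs-disjoint : ∀ {x y a b} → (∀ i → i < a → iter π i x ≢ y) → (∀ j → j < b → iter π j y ≢ x) →
                  ∀ {i j} → i < a → j < b → iter π i x ≢ iter π j y
  arcs-disjoint {x} {y} x-arc y-arc {i} {j} i<a j<b eq with ≤-total i j
  ... | inj₁ i≤j = y-arc (j ∸ i) (≤-<-trans (m∸n≤m j i) j<b) (sym (iter-injective i (begin
    iter π i x                  ≡⟨ eq ⟩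
    iter π j y                  ≡⟨ cong (λ k → iter π k y) (sym (m+[n∸m]≡n i≤j)) ⟩
    iter π (i + (j ∸ i)) y      ≡⟨ iter-+ π i (j ∸ i) y ⟩
    iter π i (iter π (j ∸ i) y) ∎)))
    where open ≡-Reasoning
  ... | inj₂ j≤i = x-arc (i ∸ j) (≤-<-trans (m∸n≤m i j) i<a) (iter-injective j (begin
    iter π j (iter π (i ∸ j) x) ≡⟨ sym (iter-+ π j (i ∸ j) x) ⟩
    iter π (j + (i ∸ j)) x      ≡⟨ cong (λ k → iter π k x) (m+[n∸m]≡n j≤i) ⟩
    iter π i x                  ≡⟨ eq ⟩
    iter π j y                  ∎))
    where open ≡-Reasoning

record Transposition {n : ℕ} (π ρ : Fin n → Fin n) (a b : Fin n) : Set where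
  field
    at-a      : ρ a ≡ π b
    at-b      : ρ b ≡ π a
    elsewhere : ∀ h → h ≢ a → h ≢ b → ρ h ≡ π h

transposition-sym : ∀ {n} {π ρ : Fin n → Fin n} {a b} → Transposition π ρ a b → Transposition ρ π a b
transposition-sym τ = record
  { at-a = sym at-b ; at-b = sym at-a ; elsewhere = λ h h≢a h≢b → sym (elsewhere h h≢a h≢b) }
  where open Transposition τ

transposition-agrees : ∀ {n} {π ρ : Fin n → Fin n} {a b} → Transposition π ρ a b → ∀ m x →
                       (∀ r → r < m → iter π r x ≢ a × iter π r x ≢ b) → iter ρ m x ≡ iter π m x
transposition-agrees τ zero    x avoid = refl
transposition-agrees {π = π} τ (suc m) x avoid
  rewrite transposition-agrees τ m x (λ r r<m → avoid r (m<n⇒m<1+n r<m)) =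
  Transposition.elsewhere τ (iter π m x) (proj₁ (avoid m ≤-refl)) (proj₂ (avoid m ≤-refl))

module Transposed {n : ℕ} {π ρ : Fin n → Fin n} (π-injective : Injective _≡_ _≡_ π)
                  (ρ-injective : Injective _≡_ _≡_ ρ) {a b : Fin n} (a≢b : a ≢ b)
                  (τ : Transposition π ρ a b) where

  open Transposition τ
  module π = Cycles π π-injective
  module ρ = Cycles ρ ρ-injective

  ↝-transfer : a ρ.↝ b → ∀ {x y} → x π.↝ y → x ρ.↝ y
  ↝-transfer a↝b {x} (k , refl) = along k
    where
    π-step : ∀ z → z ρ.↝ π z
    π-step z with z ≟ a | z ≟ b
    ... | yes refl | _        = ρ.↝-trans a↝b (subst (b ρ.↝_) at-b (ρ.↝-step b))
    ... | no _     | yes refl = ρ.↝-trans (ρ.↝-sym a↝b) (subst (a ρ.↝_) at-a (ρ.↝-step a))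
    ... | no z≢a   | no z≢b   = subst (z ρ.↝_) (elsewhere z z≢a z≢b) (ρ.↝-step z)
    along : ∀ k → x ρ.↝ iter π k x
    along zero    = ρ.↝-refl
    along (suc k) = ρ.↝-trans (along k) (π-step _)

  cover : ∀ {y} → a π.↝ y → a ρ.↝ y ⊎ b ρ.↝ y
  cover (zero , refl) = inj₁ ρ.↝-refl
  cover (suc k , refl) with cover (k , refl) | iter π k a ≟ a | iter π k a ≟ b
  ... | _      | yes eq | _      = inj₂ (subst (b ρ.↝_) (trans at-b (cong π (sym eq))) (ρ.↝-step b))
  ... | _      | no _   | yes eq = inj₁ (subst (a ρ.↝_) (trans at-a (cong π (sym eq))) (ρ.↝-step a))
  ... | inj₁ r | no ≢a  | no ≢b  = inj₁ (ρ.↝-trans r (subst (_ ρ.↝_) (elsewhere _ ≢a ≢b) (ρ.↝-step _)))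
  ... | inj₂ r | no ≢a  | no ≢b  = inj₂ (ρ.↝-trans r (subst (_ ρ.↝_) (elsewhere _ ≢a ≢b) (ρ.↝-step _)))

  agree-off-orbit : a π.↝ b → ∀ {x} → ¬ a π.↝ x → ∀ k → iter ρ k x ≡ iter π k x
  agree-off-orbit a↝b {x} a↝̸x k = transposition-agrees τ k x λ r _ →
    (λ eq → a↝̸x (π.↝-sym (r , eq))) , (λ eq → a↝̸x (π.↝-trans a↝b (π.↝-sym (r , eq))))

  -- The ρ-orbit of a is {a} ∪ {πˢ b | 0 < s < i}, where i is least with πⁱ b = a.
  separates : a π.↝ b → ¬ a ρ.↝ b
  separates a↝b with π.first-arrival (π.↝-sym a↝b)
  ... | i , πⁱb≡a , before-i = λ (k , ρᵏa≡b) → b∉X (subst X ρᵏa≡b (ρ-iterates k))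
    where
    no-return : ∀ s → 0 < s → s < i → iter π s b ≢ b
    no-return s 0<s s<i eq = before-i (i ∸ s) (∸-monoʳ-< 0<s (<⇒≤ s<i)) (begin
      iter π (i ∸ s) b            ≡⟨ cong (iter π (i ∸ s)) (sym eq) ⟩
      iter π (i ∸ s) (iter π s b) ≡⟨ sym (iter-+ π (i ∸ s) s b) ⟩
      iter π (i ∸ s + s) b        ≡⟨ cong (λ m → iter π m b) (m∸n+n≡m (<⇒≤ s<i)) ⟩
      iter π i b                  ≡⟨ πⁱb≡a ⟩
      a                           ∎)
      where open ≡-Reasoning
    X : Fin n → Set
    X x = x ≡ a ⊎ ∃ λ s → 0 < s × s < i × iter π s b ≡ x
    ρ-closed : ∀ {x} → X x → X (ρ x)
    ρ-closed (inj₁ refl) with <-cmp 1 i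
    ... | tri< 1<i _ _  = inj₂ (1 , s≤s z≤n , 1<i , sym at-a)
    ... | tri≈ _ refl _ = inj₁ (trans at-a πⁱb≡a)
    ... | tri> _ _ i<1 with refl ← n<1⇒n≡0 i<1 = ⊥-elim (a≢b (sym πⁱb≡a))
    ρ-closed (inj₂ (s , 0<s , s<i , refl)) with m≤n⇒m<n∨m≡n s<i
    ... | inj₁ 1+s<i = inj₂ (suc s , s≤s z≤n , 1+s<i , sym (elsewhere _ (before-i s s<i) (no-return s 0<s s<i)))
    ... | inj₂ refl  = inj₁ (trans (elsewhere _ (before-i s s<i) (no-return s 0<s s<i)) πⁱb≡a)
    ρ-iterates : ∀ k → X (iter ρ k a)
    ρ-iterates zero    = inj₁ refl
    ρ-iterates (suc k) = ρ-closed (ρ-iterates k)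
    b∉X : ¬ X b
    b∉X (inj₁ b≡a)                  = a≢b (sym b≡a)
    b∉X (inj₂ (s , 0<s , s<i , eq)) = no-return s 0<s s<i eq

  joins : ¬ a π.↝ b → b ρ.↝ a
  joins a↝̸b with π.first-return a
  ... | p , πᵖ⁺¹a≡a , before-p = suc p , trans (follows p ≤-refl) πᵖ⁺¹a≡a
    where
    follows : ∀ s → s ≤ p → iter ρ (suc s) b ≡ iter π (suc s) a
    follows zero    _   = at-b
    follows (suc s) s<p rewrite follows s (<⇒≤ s<p) = elsewhere _ (before-p s s<p) (λ eq → a↝̸b (suc s , eq))

module TranspositionCycles {n : ℕ} {π ρ : Fin n → Fin n} (π-injective : Injective _≡_ _≡_ π)
                           (ρ-injective : Injective _≡_ _≡_ ρ) {a b : Fin n} (a≢b : a ≢ b)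
                           (τ : Transposition π ρ a b) where

  private
    module τ  = Transposed π-injective ρ-injective a≢b τ
    module τ⁻ = Transposed ρ-injective π-injective a≢b (transposition-sym τ)
  open τ using (module π; module ρ)

  module _ (a↝b : a π.↝ b) where

    private
      ρ⊆π : ∀ {x y} → x ρ.↝ y → x π.↝ y
      ρ⊆π = τ⁻.↝-transfer a↝b

      π-leader⇒ρ-leader : ∀ {x} → π.isLeader x ≡ true → ρ.isLeader x ≡ true
      π-leader⇒ρ-leader leads = ρ.≤⇒leader λ r → π.leader⇒≤ leads (ρ⊆π r)

      -- a′ is the one of a, b whose ρ-cycle contains the π-leader m of the cycle of a;
      -- the ρ-leader z of the cycle of the other one, b′, is the single new leader.
      new-leader : ∀ {m a′ b′} → π.isLeader m ≡ true → a π.↝ m →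
                   (∀ {y} → a π.↝ y → a′ ρ.↝ y ⊎ b′ ρ.↝ y) → ¬ a′ ρ.↝ b′ → a′ ρ.↝ m → a π.↝ b′ →
                   ρ.cycles ≡ suc π.cycles
      new-leader {m} {a′} {b′} m-leads a↝m covers a′↝̸b′ a′↝m a↝b′ with ρ.leader-of b′
      ... | z , b′↝z , z-leads = countF-flip z z-not-π-leader z-leads same-leaders
        where
        a↝z : a π.↝ z
        a↝z = π.↝-trans a↝b′ (ρ⊆π b′↝z)
        m≢z : m ≢ z
        m≢z refl = a′↝̸b′ (ρ.↝-trans a′↝m (ρ.↝-sym b′↝z))
        z-not-π-leader : π.isLeader z ≡ false
        z-not-π-leader = π.≰⇒¬leader (π.↝-trans (π.↝-sym a↝z) a↝m)
          (≤∧≢⇒< (π.leader⇒≤ m-leads (π.↝-trans (π.↝-sym a↝m) a↝z)) (m≢z ∘ Fin.toℕ-injective))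
        same-leaders : ∀ h → h ≢ z → π.isLeader h ≡ ρ.isLeader h
        same-leaders h h≢z with a π.↝? h
        ... | no a↝̸h = isLeader-cong λ k → sym (τ.agree-off-orbit a↝b a↝̸h k)
        ... | yes a↝h with π.isLeader h in π-leads | ρ.isLeader h in ρ-leads
        ...   | true  | true  = refl
        ...   | false | false = refl
        ...   | true  | false with () ← trans (sym (π-leader⇒ρ-leader π-leads)) ρ-leads
        ...   | false | true  with covers a↝h
        ...     | inj₁ a′↝h
                  with refl ← ρ.leader-unique (π-leader⇒ρ-leader m-leads) ρ-leads (ρ.↝-trans (ρ.↝-sym a′↝m) a′↝h)
                  with () ← trans (sym m-leads) π-leads
        ...     | inj₂ b′↝h = ⊥-elim (h≢z (ρ.leader-unique ρ-leads z-leads (ρ.↝-trans (ρ.↝-sym b′↝h) b′↝z)))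

    cycles-split : ρ.cycles ≡ suc π.cycles
    cycles-split with π.leader-of a
    ... | m , a↝m , m-leads with τ.cover a↝m
    ...   | inj₁ a↝m′ = new-leader m-leads a↝m τ.cover (τ.separates a↝b) a↝m′ a↝b
    ...   | inj₂ b↝m′ = new-leader m-leads a↝m (λ r → [ inj₂ , inj₁ ]′ (τ.cover r))
                                   (λ r → τ.separates a↝b (ρ.↝-sym r)) b↝m′ π.↝-refl

cycles-merge : ∀ {n} {π ρ : Fin n → Fin n} (π-injective : Injective _≡_ _≡_ π)
               (ρ-injective : Injective _≡_ _≡_ ρ) {a b} (a≢b : a ≢ b) (τ : Transposition π ρ a b) →
               ¬ Orbits._↝_ π a b → Orbits.cycles π ≡ suc (Orbits.cycles ρ)
cycles-merge π-injective ρ-injective a≢b τ a↝̸b =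
  TranspositionCycles.cycles-split ρ-injective π-injective a≢b (transposition-sym τ)
    (Cycles.↝-sym _ ρ-injective (Transposed.joins π-injective ρ-injective a≢b τ a↝̸b))

+-2+ : ∀ m n → m + (2 + n) ≡ 2 + (m + n)
+-2+ m n = trans (+-suc m (suc n)) (cong suc (+-suc m n))

module Submaps {n : ℕ} (s : Fin n → Fin n) (s-injective : Injective _≡_ _≡_ s)
               (β : Fin n → Fin n) (β-involutive : ∀ h → β (β h) ≡ h) where

  Closed : (Fin n → Bool) → Set
  Closed S = ∀ h → S (β h) ≡ S h

  β-on : (Fin n → Bool) → Fin n → Fin n
  β-on S h = if S h then β h else h

  -- The face permutation of the submap whose edges are the β-pairs in S; half-edges outside S become legs.
  ψ : (Fin n → Bool) → Fin n → Fin n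
  ψ S = s ∘ β-on S

  faces : (Fin n → Bool) → ℕ
  faces S = Orbits.cycles (ψ S)

  β-injective : Injective _≡_ _≡_ β
  β-injective {x} {y} eq = trans (sym (β-involutive x)) (trans (cong β eq) (β-involutive y))

  β-on-true : ∀ S {x} → S x ≡ true → β-on S x ≡ β x
  β-on-true S Sx rewrite Sx = refl

  β-on-false : ∀ S {x} → S x ≡ false → β-on S x ≡ x
  β-on-false S Sx rewrite Sx = refl

  β-on-involutive : ∀ {S} → Closed S → ∀ h → β-on S (β-on S h) ≡ h
  β-on-involutive {S} closed h with S h in Sh
  ... | true  rewrite closed h | Sh = β-involutive h
  ... | false rewrite Sh = refl

  ψ-injective : ∀ {S} → Closed S → Injective _≡_ _≡_ (ψ S)
  ψ-injective {S} closed {x} {y} eq =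
    trans (sym (β-on-involutive closed x)) (trans (cong (β-on S) (s-injective eq)) (β-on-involutive closed y))

  remove : Fin n → (Fin n → Bool) → Fin n → Bool
  remove h S = erase (β h) (erase h S)

  module _ (h : Fin n) (S : Fin n → Bool) where

    remove-at : remove h S h ≡ false
    remove-at = erase-false (erase h S) (erase-≡ h S)

    remove-at-β : remove h S (β h) ≡ false
    remove-at-β = erase-≡ (β h) (erase h S)

    remove-elsewhere : ∀ {x} → x ≢ h → x ≢ β h → remove h S x ≡ S x
    remove-elsewhere x≢h x≢βh = trans (erase-≢ (erase h S) x≢βh) (erase-≢ S x≢h)

    remove-closed : Closed S → Closed (remove h S)
    remove-closed closed x = by-cases (x ≟ h) (x ≟ β h)
      where
      by-cases : Dec (x ≡ h) → Dec (x ≡ β h) → remove h S (β x) ≡ remove h S x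
      by-cases (yes refl) _          = trans remove-at-β (sym remove-at)
      by-cases (no _)     (yes refl) rewrite β-involutive h = trans remove-at (sym remove-at-β)
      by-cases (no x≢h)   (no x≢βh)  =
        trans (remove-elsewhere (λ eq → x≢βh (trans (sym (β-involutive x)) (cong β eq))) (x≢h ∘ β-injective))
              (trans (closed x) (sym (remove-elsewhere x≢h x≢βh)))

    remove-transposition : Closed S → S h ≡ true → Transposition (ψ S) (ψ (remove h S)) h (β h)
    remove-transposition closed Sh = record
      { at-a      = cong s (trans (β-on-false (remove h S) remove-at)
                                  (sym (trans (β-on-true S (trans (closed h) Sh)) (β-involutive h))))
      ; at-b      = cong s (trans (β-on-false (remove h S) remove-at-β) (sym (β-on-true S Sh)))
      ; elsewhere = λ x x≢h x≢βh → cong (λ b → s (if b then β x else x)) (remove-elsewhere x≢h x≢βh)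
      }

    countF-remove : ∀ {S₀} → Closed S → Closed S₀ → (S ∖ S₀) h ≡ true → h ≢ β h →
                    countF (S ∖ S₀) ≡ 2 + countF (remove h S ∖ S₀)
    countF-remove {S₀} closed closed₀ new h≢βh = begin
      countF (S ∖ S₀)                                 ≡⟨ countF-erase h new ⟩
      1 + countF (erase h (S ∖ S₀))                   ≡⟨ cong suc (countF-erase (β h) new-at-β) ⟩
      2 + countF (erase (β h) (erase h (S ∖ S₀)))     ≡⟨ cong (2 +_) (countF-cong λ x → ∧-shuffle (S x) _ _ _) ⟩
      2 + countF (remove h S ∖ S₀)                    ∎
      where
      open ≡-Reasoning
      new-at-β : erase h (S ∖ S₀) (β h) ≡ true
      new-at-β = trans (erase-≢ (S ∖ S₀) (h≢βh ∘ sym))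
                       (trans (cong₂ (λ a b → a ∧ not b) (closed h) (closed₀ h)) new)
      ∧-shuffle : ∀ a b c d → ((a ∧ b) ∧ c) ∧ d ≡ ((a ∧ c) ∧ d) ∧ b
      ∧-shuffle false b     c d = refl
      ∧-shuffle true  false c d = sym (∧-zeroʳ _)
      ∧-shuffle true  true  c d = sym (∧-identityʳ _)

  private
    split-bounds : ∀ {A A′ B D} → A′ ≡ 2 + A → A′ ≤ B + D → B ≤ A′ + D →
                   A ≤ B + (2 + D) × B ≤ A + (2 + D) × A ≢ B + (2 + D)
    split-bounds {A} {A′} {B} {D} refl upper lower =
      ≤-trans (m≤n+m A 2) (≤-trans upper (+-monoʳ-≤ B (m≤n+m D 2))) ,
      subst (B ≤_) (sym (+-2+ A D)) lower ,
      λ eq → <-irrefl refl (<-≤-trans (≤-trans (n≤1+n _) (≤-trans (≤-reflexive (sym (trans eq (+-2+ B D))))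
                                                                  (m≤n+m A 2)))
                                      upper)

    merge-bounds : ∀ {A A′ B D} → A ≡ 2 + A′ → A′ ≤ B + D → B ≤ A′ + D →
                   A ≤ B + (2 + D) × B ≤ A + (2 + D) × (A ≡ B + (2 + D) → A′ ≡ B + D)
    merge-bounds {A} {A′} {B} {D} refl upper lower =
      subst (2 + A′ ≤_) (sym (+-2+ B D)) (s≤s (s≤s upper)) ,
      ≤-trans lower (+-mono-≤ (m≤n+m A′ 2) (m≤n+m D 2)) ,
      λ eq → suc-injective (suc-injective (trans eq (+-2+ B D)))

    double-suc : ∀ {a b} → a ≡ suc b → 2 * a ≡ 2 + 2 * b
    double-suc {b = b} refl = *-suc 2 b

  module _ {S₀ : Fin n → Bool} (closed₀ : Closed S₀) where

    record FaceBounds (S : Fin n → Bool) : Set where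
      field
        upper         : 2 * faces S ≤ 2 * faces S₀ + countF (S ∖ S₀)
        lower         : 2 * faces S₀ ≤ 2 * faces S + countF (S ∖ S₀)
        tight⇒coarser : 2 * faces S ≡ 2 * faces S₀ + countF (S ∖ S₀) →
                        ∀ {x y} → Orbits._↝_ (ψ S) x y → Orbits._↝_ (ψ S₀) x y

    same-face-bounds : ∀ {S} → (∀ x → S x ≡ S₀ x) → FaceBounds S
    same-face-bounds {S} S≗S₀ = record
      { upper         = ≤-trans (≤-reflexive (cong (2 *_) same-faces)) (m≤m+n _ _)
      ; lower         = ≤-trans (≤-reflexive (cong (2 *_) (sym same-faces))) (m≤m+n _ _)
      ; tight⇒coarser = λ _ {x} (k , reach) → k , trans (sym (iter-cong ψS≗ψS₀ k x)) reach
      }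
      where
      ψS≗ψS₀ : ∀ x → ψ S x ≡ ψ S₀ x
      ψS≗ψS₀ x = cong (λ b → s (if b then β x else x)) (S≗S₀ x)
      same-faces : faces S ≡ faces S₀
      same-faces = cycles-cong ψS≗ψS₀

    -- Adding the edge {h, β h} to remove h S composes its face permutation with the transposition
    -- (h β h): this splits a face when h and β h lie on one, and merges two faces otherwise.
    module _ {S h} (closed : Closed S) (new : (S ∖ S₀) h ≡ true) (h≢βh : h ≢ β h)
             (smaller : FaceBounds (remove h S)) where

      private
        module S′ = FaceBounds smaller
        closed′ : Closed (remove h S)
        closed′ = remove-closed h S closed
        τ : Transposition (ψ S) (ψ (remove h S)) h (β h)
        τ = remove-transposition h S closed (∖-left S S₀ new)
        count : countF (S ∖ S₀) ≡ 2 + countF (remove h S ∖ S₀)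
        count = countF-remove h S closed closed₀ new h≢βh
        ψS-injective : Injective _≡_ _≡_ (ψ S)
        ψS-injective = ψ-injective closed
        ψS′-injective : Injective _≡_ _≡_ (ψ (remove h S))
        ψS′-injective = ψ-injective closed′
        split : Orbits._↝_ (ψ S) h (β h) → faces (remove h S) ≡ suc (faces S)
        split = TranspositionCycles.cycles-split ψS-injective ψS′-injective h≢βh τ
        merge : ¬ Orbits._↝_ (ψ S) h (β h) → faces S ≡ suc (faces (remove h S))
        merge = cycles-merge ψS-injective ψS′-injective h≢βh τ
        S⊆S′ : ¬ Orbits._↝_ (ψ S) h (β h) → ∀ {x y} → Orbits._↝_ (ψ S) x y → Orbits._↝_ (ψ (remove h S)) x y
        S⊆S′ h↝̸βh = Transposed.↝-transfer ψS-injective ψS′-injective h≢βh τ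
          (Cycles.↝-sym (ψ (remove h S)) ψS′-injective (Transposed.joins ψS-injective ψS′-injective h≢βh τ h↝̸βh))

      add-edge : FaceBounds S
      add-edge with Cycles._↝?_ (ψ S) ψS-injective h (β h)
      ... | yes h↝βh with split-bounds (double-suc (split h↝βh)) S′.upper S′.lower
      ...   | upper , lower , loose = record
        { upper         = subst (λ c → 2 * faces S ≤ 2 * faces S₀ + c) (sym count) upper
        ; lower         = subst (λ c → 2 * faces S₀ ≤ 2 * faces S + c) (sym count) lower
        ; tight⇒coarser = λ tight → ⊥-elim (loose (trans tight (cong (2 * faces S₀ +_) count)))
        }
      add-edge | no h↝̸βh with merge-bounds (double-suc (merge h↝̸βh)) S′.upper S′.lower
      ...   | upper , lower , tight′ = record
        { upper         = subst (λ c → 2 * faces S ≤ 2 * faces S₀ + c) (sym count) upper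
        ; lower         = subst (λ c → 2 * faces S₀ ≤ 2 * faces S + c) (sym count) lower
        ; tight⇒coarser = λ tight →
            S′.tight⇒coarser (tight′ (trans tight (cong (2 * faces S₀ +_) count))) ∘ S⊆S′ h↝̸βh
        }

    face-bounds-below : ∀ m {S} → Closed S → (∀ x → S₀ x ≡ true → S x ≡ true) →
                        (∀ x → S x ≡ true → S₀ x ≡ false → x ≢ β x) → countF (S ∖ S₀) ≤ m → FaceBounds S
    face-bounds-below m {S} closed S₀⊆S no-loop bound with countF (S ∖ S₀) in c
    ... | zero = same-face-bounds λ x → ∖-false S S₀ (S₀⊆S x) (countF-≡0 c x)
    face-bounds-below (suc m) {S} closed S₀⊆S no-loop bound | suc _
      with h , new ← countF-witness (subst (0 <_) (sym c) (s≤s z≤n)) =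
      add-edge closed new h≢βh (face-bounds-below m (remove-closed h S closed) S₀⊆S′ no-loop′ bound′)
      where
      S₀h : S₀ h ≡ false
      S₀h = ∖-right S S₀ new
      h≢βh : h ≢ β h
      h≢βh = no-loop h (∖-left S S₀ new) S₀h
      S₀βh : S₀ (β h) ≡ false
      S₀βh = trans (closed₀ h) S₀h
      S₀⊆S′ : ∀ x → S₀ x ≡ true → remove h S x ≡ true
      S₀⊆S′ x S₀x = trans (remove-elsewhere h S (λ { refl → contradiction (trans (sym S₀x) S₀h) λ () })
                                                (λ { refl → contradiction (trans (sym S₀x) S₀βh) λ () }))
                          (S₀⊆S x S₀x)
      no-loop′ : ∀ x → remove h S x ≡ true → S₀ x ≡ false → x ≢ β x
      no-loop′ x S′x = no-loop x (erase-⊆ S (erase-⊆ (erase h S) S′x))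
      bound′ : countF (remove h S ∖ S₀) ≤ m
      bound′ = s≤s⁻¹ (≤-trans (n≤1+n _) (≤-trans (≤-reflexive (trans (sym removed) c)) bound))
        where removed = countF-remove h S closed closed₀ new h≢βh

    face-bounds : ∀ {S} → Closed S → (∀ x → S₀ x ≡ true → S x ≡ true) →
                  (∀ x → S x ≡ true → S₀ x ≡ false → x ≢ β x) → FaceBounds S
    face-bounds closed S₀⊆S no-loop = face-bounds-below _ closed S₀⊆S no-loop ≤-refl

Unique-++⁻ : ∀ (xs : List A) {ys} → Unique (xs ++ ys) →
             Unique xs × Unique ys × (∀ {z} → z ∈ xs → z ∉ ys)
Unique-++⁻ []       u        = [] , u , λ ()
Unique-++⁻ (x ∷ xs) (x∉ ∷ u) with Unique-++⁻ xs u
... | uxs , uys , disjoint =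
  All.++⁻ˡ xs x∉ ∷ uxs , uys ,
  λ { (here refl) → All.All¬⇒¬Any (All.++⁻ʳ xs x∉) ; (there z∈xs) → disjoint z∈xs }

module WalkProperties (G : GrowingMap) where

  open GrowingMap G
  open import Data.List.Membership.DecPropositional (_≟_ {V}) using (_∈?_)

  opp : Fin n → Fin n
  opp h = α ⟨$⟩ʳ h

  opp-injective : ∀ {x y} → opp x ≡ opp y → x ≡ y
  opp-injective {x} {y} eq = trans (sym (α-invol x)) (trans (cong opp eq) (α-invol y))

  opp-NotLeg : ∀ {h} → NotLeg h → NotLeg (opp h)
  opp-NotLeg {h} h-edge loop = h-edge (opp-injective loop)

  Connected : (Fin n → Set) → Fin V → Fin V → Set
  Connected P x y = ∃ λ hs → Walk P x hs y

  Symmetric : (Fin n → Set) → Set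
  Symmetric P = ∀ h → P h → P (opp h)

  private
    variable
      P Q : Fin n → Set
      x y z : Fin V
      hs ks : List (Fin n)

  walk-map : (∀ h → P h → Q h) → Walk P x hs y → Walk Q x hs y
  walk-map P⊆Q nil                 = nil
  walk-map P⊆Q (cons p h-edge e w) = cons (P⊆Q _ p) h-edge e (walk-map P⊆Q w)

  infixr 5 _++ʷ_

  _++ʷ_ : Walk P x hs y → Walk P y ks z → Walk P x (hs ++ ks) z
  nil               ++ʷ w′ = w′
  cons p h-edge e w ++ʷ w′ = cons p h-edge e (w ++ʷ w′)

  connected-trans : Connected P x y → Connected P y z → Connected P x z
  connected-trans (_ , w) (_ , w′) = _ , w ++ʷ w′

  connected-sym : Symmetric P → Connected P x y → Connected P y x
  connected-sym P-sym (_ , nil) = _ , nil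
  connected-sym {P} P-sym (_ , cons {h = h} p h-edge refl w) =
    connected-trans (connected-sym P-sym (_ , w))
      (_ , cons (P-sym h p) (opp-NotLeg h-edge) refl
                (subst (λ v → Walk P v [] (vert h)) (sym (cong vert (α-invol h))) nil))

  start∈visited : ∀ x hs → x ∈ visited x hs
  start∈visited x []      = here refl
  start∈visited x (_ ∷ _) = here refl

  end∈visited : Walk P x hs y → y ∈ visited x hs
  end∈visited nil            = here refl
  end∈visited (cons _ _ _ w) = there (end∈visited w)

  ends∈visited : ∀ {k} → Walk P x hs y → k ∈ hs → vert k ∈ visited x hs × vert (opp k) ∈ visited x hs
  ends∈visited (cons _ _ refl w) (here refl)  = here refl , there (start∈visited _ _)
  ends∈visited (cons _ _ _ w)    (there k∈hs) with ends∈visited w k∈hs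
  ... | k-end , opp-end = there k-end , there opp-end

  walk-∈ : ∀ {k} → Walk P x hs y → k ∈ hs → P k
  walk-∈ (cons p _ _ _) (here refl)  = p
  walk-∈ (cons _ _ _ w) (there k∈hs) = walk-∈ w k∈hs

  walk-restrict : Walk P x hs y → (∀ k → k ∈ hs → Q k) → Walk (λ k → P k × Q k) x hs y
  walk-restrict nil                 q = nil
  walk-restrict (cons p h-edge e w) q =
    cons (p , q _ (here refl)) h-edge e (walk-restrict w (λ k → q k ∘ there))

  visited⁺ : Fin V → List (Fin n) → List (Fin V)
  visited⁺ y []       = []
  visited⁺ y (h ∷ hs) = visited (vert (opp h)) hs

  visited-++ : ∀ ks → Walk P x hs y → visited x (hs ++ ks) ≡ visited x hs ++ visited⁺ y ks
  visited-++ []      nil            = refl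
  visited-++ (_ ∷ _) nil            = refl
  visited-++ ks      (cons _ _ _ w) = cong (_ ∷_) (visited-++ ks w)

  walk-split : Walk P x hs y → z ∈ visited x hs →
               ∃ λ hs₁ → ∃ λ hs₂ → hs ≡ hs₁ ++ hs₂ × Walk P x hs₁ z × Walk P z hs₂ y
  walk-split nil                 (here refl) = [] , [] , refl , nil , nil
  walk-split w@(cons _ _ _ _)    (here refl) = [] , _ , refl , nil , w
  walk-split (cons p h-edge e w) (there z∈)  with walk-split w z∈
  ... | hs₁ , hs₂ , refl , w₁ , w₂ = _ ∷ hs₁ , hs₂ , refl , cons p h-edge e w₁ , w₂

  visited-∷ : ∀ z hs → visited z hs ≡ z ∷ visited⁺ z hs
  visited-∷ z []      = refl
  visited-∷ z (_ ∷ _) = refl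

  module _ {hs₁ hs₂} (w₁ : Walk P x hs₁ y) (u : Unique (visited x (hs₁ ++ hs₂))) where

    private
      split-visited : Unique (visited x hs₁) × Unique (visited⁺ y hs₂) ×
                      (∀ {z} → z ∈ visited x hs₁ → z ∉ visited⁺ y hs₂)
      split-visited = Unique-++⁻ (visited x hs₁) (subst Unique (visited-++ hs₂ w₁) u)

    prefix-unique : Unique (visited x hs₁)
    prefix-unique = proj₁ split-visited

    suffix-unique : Unique (visited y hs₂)
    suffix-unique rewrite visited-∷ y hs₂ =
      All.¬Any⇒All¬ _ (proj₂ (proj₂ split-visited) (end∈visited w₁)) ∷ proj₁ (proj₂ split-visited)

    prefix-suffix-disjoint : ∀ {z} → z ∈ visited x hs₁ → z ∉ visited⁺ y hs₂
    prefix-suffix-disjoint = proj₂ (proj₂ split-visited)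

  walk-simplify : Walk P x hs y →
                  ∃ λ ks → Walk P x ks y × Unique (visited x ks) × (∀ k → k ∈ ks → k ∈ hs)
  walk-simplify nil = [] , nil , [] ∷ [] , λ _ ()
  walk-simplify {x = x} (cons {h = h} p h-edge e w) with walk-simplify w
  ... | ks , w′ , u , ks⊆hs with x ∈? visited (vert (opp h)) ks
  ...   | yes x∈ with walk-split w′ x∈
  ...     | ks₁ , ks₂ , refl , w₁ , w₂ =
    ks₂ , w₂ , suffix-unique w₁ u , λ k → there ∘ ks⊆hs k ∘ ∈-++⁺ʳ ks₁
  walk-simplify (cons p h-edge e w) | ks , w′ , u , ks⊆hs | no x∉ =
    _ ∷ ks , cons p h-edge e w′ , All.¬Any⇒All¬ _ x∉ ∷ u ,
    λ { k (here refl) → here refl ; k (there k∈ks) → there (ks⊆hs k k∈ks) }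

  edgeOf-≡ : ∀ h k → edgeOf h ≡ edgeOf k → k ≡ h ⊎ k ≡ opp h
  edgeOf-≡ h k eq with toℕ h ≤ᵇ toℕ (opp h) | toℕ k ≤ᵇ toℕ (opp k)
  ... | true  | true  = inj₁ (sym eq)
  ... | true  | false = inj₂ (trans (sym (α-invol k)) (cong opp (sym eq)))
  ... | false | true  = inj₂ (sym eq)
  ... | false | false = inj₁ (opp-injective (sym eq))

  edgesOf-∈ : ∀ {e} hs → e ∈ edgesOf hs → ∃ λ k → k ∈ hs × e ≡ edgeOf k
  edgesOf-∈ (h ∷ hs) (here refl) = h , here refl , refl
  edgesOf-∈ (h ∷ hs) (there e∈)  with edgesOf-∈ hs e∈
  ... | k , k∈hs , refl = k , there k∈hs , refl

  avoids : ∀ {h} → All (vert h ≢_) (visited x hs) → Walk P x hs y →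
           ∀ k → k ∈ hs → k ≢ h × k ≢ opp h
  avoids {h = h} fresh w k k∈hs =
    (λ { refl → All.All¬⇒¬Any fresh (proj₁ (ends∈visited w k∈hs)) }) ,
    (λ { refl → All.All¬⇒¬Any fresh (subst (λ v → vert v ∈ _) (α-invol h)
                                             (proj₂ (ends∈visited w k∈hs))) })

  edge∉edgesOf : ∀ {h} → (∀ k → k ∈ hs → k ≢ h × k ≢ opp h) → edgeOf h ∉ edgesOf hs
  edge∉edgesOf {h = h} avoid e∈ with edgesOf-∈ _ e∈
  ... | k , k∈hs , eq with edgeOf-≡ h k eq
  ...   | inj₁ refl = proj₁ (avoid k k∈hs) refl
  ...   | inj₂ refl = proj₂ (avoid k k∈hs) refl

  simple⇒edges-unique : Walk P x hs y → Unique (visited x hs) → Unique (edgesOf hs)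
  simple⇒edges-unique nil               _           = []
  simple⇒edges-unique (cons _ _ refl w) (fresh ∷ u) =
    All.¬Any⇒All¬ _ (edge∉edgesOf (avoids fresh w)) ∷ simple⇒edges-unique w u

module TreeProperties (M : TreeGrowingMap) where

  open TreeGrowingMap M
  open WalkProperties gm public

  T-without : Fin n → Fin n → Set
  T-without d h = T h × h ≢ d × h ≢ opp d

  T-without-sym : ∀ d → Symmetric (T-without d)
  T-without-sym d h (Th , h≢d , h≢d′) =
    T-sym h Th , (λ eq → h≢d′ (trans (sym (α-invol h)) (cong opp eq))) , (λ eq → h≢d (opp-injective eq))

  tree-bridge : ∀ {d} → T d → ¬ Connected (T-without d) (vert (opp d)) (vert d)
  tree-bridge {d} Td (_ , w) with walk-simplify w
  ... | ks , w′ , u , _ =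
    T-acyclic (vert d , d , ks , cons Td (T-notLeg d Td) refl (walk-map (λ _ → proj₁) w′) ,
               All.¬Any⇒All¬ _ (edge∉edgesOf (λ k k∈ks → proj₂ (walk-∈ w′ k∈ks)))
               ∷ simple⇒edges-unique w′ u)

  tree-path-unique : ∀ {x y hs ks} → Walk T x hs y → Unique (visited x hs) →
                     Walk T x ks y → Unique (visited x ks) → hs ≡ ks
  tree-path-unique nil _ nil _ = refl
  tree-path-unique nil _ (cons _ _ refl w) (fresh ∷ _) = ⊥-elim (All.All¬⇒¬Any fresh (end∈visited w))
  tree-path-unique (cons _ _ refl w) (fresh ∷ _) nil _ = ⊥-elim (All.All¬⇒¬Any fresh (end∈visited w))
  tree-path-unique (cons {h = h} Th _ refl w) (fresh ∷ u) (cons {h = k} Tk k-edge k-at w′) (fresh′ ∷ u′)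
    with h ≟ k
  ... | yes refl = cong (h ∷_) (tree-path-unique w u w′ u′)
  ... | no h≢k   = ⊥-elim (tree-bridge Th (connected-trans (_ , walk-restrict w (avoids fresh w))
                    (connected-sym (T-without-sym h) (_ , walk-restrict back avoid-back))))
    where
    back : Walk T (vert h) (k ∷ _) _
    back = cons Tk k-edge k-at w′
    avoid-back : ∀ k′ → k′ ∈ (k ∷ _) → k′ ≢ h × k′ ≢ opp h
    avoid-back k′ (here refl) = h≢k ∘ sym ,
      λ { refl → All.All¬⇒¬Any fresh (subst (_∈ visited (vert (opp h)) _) k-at (start∈visited _ _)) }
    avoid-back k′ (there k′∈) = avoids fresh′ w′ k′ k′∈

  record Separation (u v hv w : Fin V) : Set where
    field
      edge       : Fin n
      edge-in-T  : T edge
      edge-at    : vert edge ≡ v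
      inner      : Connected (T-without edge) u v
      outer-head : Connected (T-without edge) (vert (opp edge)) hv
      outer-leg  : Connected (T-without edge) (vert (opp edge)) w

    separated : ∀ {x y} → x ≡ hv ⊎ x ≡ w → y ≡ u ⊎ y ≡ v → ¬ Connected (T-without edge) x y
    separated x-out y-in x↝y = tree-bridge edge-in-T
      (connected-trans (from-outside x-out)
                       (connected-trans x↝y (subst (Connected _ _) (sym edge-at) (to-v y-in))))
      where
      from-outside : ∀ {x} → x ≡ hv ⊎ x ≡ w → Connected (T-without edge) (vert (opp edge)) x
      from-outside (inj₁ refl) = outer-head
      from-outside (inj₂ refl) = outer-leg
      to-v : ∀ {y} → y ≡ u ⊎ y ≡ v → Connected (T-without edge) y v
      to-v (inj₁ refl) = inner
      to-v (inj₂ refl) = _ , nil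

  -- The separating edge is the first edge from v towards hv on the tree path from the root to hv.
  ancestor-separation : ∀ {u v hv w} (u-v : Ancestor u v) → Ancestor v hv → Ancestor w hv →
                        w ∉ visited rootVertex (proj₁ u-v) → Separation u v hv w
  ancestor-separation {u} {v} {hv} {w} (qs , wq , uq , u∈) (ps , wp , up , v∈) (ps′ , wp′ , up′ , w∈) w∉
    with tree-path-unique wp′ up′ wp up
  ... | refl with walk-split wp v∈
  ...   | ps₁ , ps₂ , refl , w₁ , w₂ with tree-path-unique w₁ (prefix-unique w₁ up) wq uq
  ...     | refl = beyond ps₂ w₂ w∈ps₂ up
    where
    w∈ps₂ : w ∈ visited⁺ v ps₂
    w∈ps₂ with ∈-++⁻ (visited rootVertex qs) (subst (w ∈_) (visited-++ ps₂ wq) w∈)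
    ... | inj₁ w∈qs = ⊥-elim (w∉ w∈qs)
    ... | inj₂ w∈′  = w∈′
    beyond : ∀ ps₂ → Walk T v ps₂ hv → w ∈ visited⁺ v ps₂ →
             Unique (visited rootVertex (qs ++ ps₂)) → Separation u v hv w
    beyond []         _                    ()  _
    beyond (d ∷ ps₂′) (cons Td _ d-at w₂′) w∈′ unique = record
      { edge = d ; edge-in-T = Td ; edge-at = d-at
      ; inner = inner
      ; outer-head = _ , walk-restrict w₂′ (avoids v∉ w₂′)
      ; outer-leg = outer-leg
      }
      where
      disjoint : ∀ {z} → z ∈ visited rootVertex qs → z ∉ visited (vert (opp d)) ps₂′
      disjoint = prefix-suffix-disjoint wq unique
      c∉ : All (vert (opp d) ≢_) (visited rootVertex qs)
      c∉ = All.¬Any⇒All¬ _ λ c∈ → disjoint c∈ (start∈visited _ ps₂′)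
      v∉ : All (vert d ≢_) (visited (vert (opp d)) ps₂′)
      v∉ = All.¬Any⇒All¬ _ λ v∈′ → disjoint (end∈visited wq) (subst (_∈ _) d-at v∈′)
      root-side : ∀ k → k ∈ qs → T k → T-without d k
      root-side k k∈ Tk with avoids c∉ wq k k∈
      ... | k≢d′ , k≢d″ = Tk , (λ eq → k≢d″ (trans eq (sym (α-invol d)))) , k≢d′
      inner : Connected (T-without d) u v
      inner with walk-split wq u∈
      ... | a₁ , a₂ , refl , _ , w-uv =
        _ , walk-map (λ k (Tk , k∈) → root-side k k∈ Tk) (walk-restrict w-uv λ k → ∈-++⁺ʳ a₁)
      outer-leg : Connected (T-without d) (vert (opp d)) w
      outer-leg with walk-split w₂′ w∈′
      ... | _ , _ , refl , w-cw , _ = _ , walk-restrict w-cw λ k k∈ → avoids v∉ w₂′ k (∈-++⁺ˡ k∈)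

  orbit-crosses : ∀ (π : Fin n → Fin n) d →
                  (∀ y → y ≢ d → y ≢ opp d → Connected (T-without d) (vert y) (vert (π y))) →
                  ∀ k x → ¬ Connected (T-without d) (vert x) (vert (iter π k x)) →
                  ∃ λ i → i < k × (iter π i x ≡ d ⊎ iter π i x ≡ opp d)
  orbit-crosses π d step zero    x apart = ⊥-elim (apart (_ , nil))
  orbit-crosses π d step (suc k) x apart with iter π k x ≟ d | iter π k x ≟ opp d
  ... | yes at-d | _          = k , ≤-refl , inj₁ at-d
  ... | no _     | yes at-d′  = k , ≤-refl , inj₂ at-d′
  ... | no ≢d    | no ≢d′
    with i , i<k , crossing ← orbit-crosses π d step k x (λ c → apart (connected-trans c (step _ ≢d ≢d′)))
    = i , m<n⇒m<1+n i<k , crossing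

transpose-i : ∀ {n} (i j : Fin n) → transpose i j i ≡ j
transpose-i i j rewrite dec-true (i ≟ i) refl = refl

transpose-j : ∀ {n} (i j : Fin n) → transpose i j j ≡ i
transpose-j i j with j ≟ i
... | yes refl = refl
... | no _ rewrite dec-true (j ≟ j) refl = refl

transpose-other : ∀ {n} {i j k : Fin n} → k ≢ i → k ≢ j → transpose i j k ≡ k
transpose-other {i = i} {j} {k} k≢i k≢j rewrite dec-false (k ≟ i) k≢i | dec-false (k ≟ j) k≢j = refl

pigeonhole-2 : ∀ {p q a b c : A} → a ≡ p ⊎ a ≡ q → b ≡ p ⊎ b ≡ q → c ≡ p ⊎ c ≡ q → a ≢ b → c ≡ a ⊎ c ≡ b
pigeonhole-2 (inj₁ refl) _           (inj₁ refl) _   = inj₁ refl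
pigeonhole-2 (inj₂ refl) _           (inj₂ refl) _   = inj₁ refl
pigeonhole-2 (inj₁ refl) (inj₂ refl) (inj₂ refl) _   = inj₂ refl
pigeonhole-2 (inj₂ refl) (inj₁ refl) (inj₁ refl) _   = inj₂ refl
pigeonhole-2 (inj₁ refl) (inj₁ refl) _           a≢b = contradiction refl a≢b
pigeonhole-2 (inj₂ refl) (inj₂ refl) _           a≢b = contradiction refl a≢b

euler-slack : ∀ {V F L N Nt Dc} → 2 * V ≤ 2 + Nt → 2 * V + 2 * F + L ≡ N + 4 → Dc + Nt + L ≡ N →
              Dc + 2 ≤ 2 * F
euler-slack {V} {F} {L} {N} {Nt} {Dc} tree-bound euler count = +-cancelˡ-≤ (2 * V) (Dc + 2) (2 * F) (begin
  2 * V + (Dc + 2)   ≤⟨ +-monoˡ-≤ (Dc + 2) tree-bound ⟩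
  2 + Nt + (Dc + 2)  ≡⟨ solve 2 (λ nt dc → con 2 :+ nt :+ (dc :+ con 2) := dc :+ nt :+ con 4) refl Nt Dc ⟩
  Dc + Nt + 4        ≡⟨ sym vertices-and-faces ⟩
  2 * V + 2 * F      ∎)
  where
  open ≤-Reasoning
  open +-*-Solver using (solve; _:=_; _:+_; con)
  vertices-and-faces : 2 * V + 2 * F ≡ Dc + Nt + 4
  vertices-and-faces = +-cancelʳ-≡ L _ _ (begin-equality
    2 * V + 2 * F + L  ≡⟨ euler ⟩
    N + 4              ≡⟨ cong (_+ 4) (sym count) ⟩
    Dc + Nt + L + 4    ≡⟨ solve 3 (λ dc nt l → dc :+ nt :+ l :+ con 4 := dc :+ nt :+ con 4 :+ l) refl Dc Nt L ⟩
    Dc + Nt + 4 + L    ∎)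

module JoinedLegs (M : TreeGrowingMap) (T? : ∀ h → Dec (TreeGrowingMap.T M h))
                  {f g : Fin (TreeGrowingMap.n M)} (f-leg : TreeGrowingMap.Leg M f)
                  (g-leg : TreeGrowingMap.Leg M g) (f≢g : f ≢ g) where

  open TreeGrowingMap M
  open TreeProperties M

  σ⁻¹ : Fin n → Fin n
  σ⁻¹ h = σ ⟨$⟩ˡ h

  σ⁻¹-injective : Injective _≡_ _≡_ σ⁻¹
  σ⁻¹-injective eq = trans (sym (inverseʳ σ)) (trans (cong (σ ⟨$⟩ʳ_) eq) (inverseʳ σ))

  vert-σ⁻¹ : ∀ h → vert (σ⁻¹ h) ≡ vert h
  vert-σ⁻¹ h = orbit-vert (σ⁻¹ h) h 1 (inverseʳ σ)

  φ-injective : Injective _≡_ _≡_ φ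
  φ-injective = opp-injective ∘ σ⁻¹-injective

  opp-fixed : ∀ {l} → Leg l → ∀ {h} → opp h ≡ l → h ≡ l
  opp-fixed l-leg eq = opp-injective (trans eq (sym l-leg))

  -- α with the legs f and g joined into a new edge
  β : Fin n → Fin n
  β h = opp (transpose f g h)

  β-f : β f ≡ g
  β-f = trans (cong opp (transpose-i f g)) g-leg

  β-g : β g ≡ f
  β-g = trans (cong opp (transpose-j f g)) f-leg

  β-other : ∀ {h} → h ≢ f → h ≢ g → β h ≡ opp h
  β-other h≢f h≢g = cong opp (transpose-other h≢f h≢g)

  β-involutive : ∀ h → β (β h) ≡ h
  β-involutive h = by-cases (h ≟ f) (h ≟ g)
    where
    by-cases : Dec (h ≡ f) → Dec (h ≡ g) → β (β h) ≡ h
    by-cases (yes refl) _          = trans (cong β β-f) β-g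
    by-cases (no _)     (yes refl) = trans (cong β β-g) β-f
    by-cases (no h≢f)   (no h≢g)   = begin
      β (β h)       ≡⟨ cong β (β-other h≢f h≢g) ⟩
      β (opp h)     ≡⟨ β-other (h≢f ∘ opp-fixed f-leg) (h≢g ∘ opp-fixed g-leg) ⟩
      opp (opp h)   ≡⟨ α-invol h ⟩
      h             ∎
      where open ≡-Reasoning

  open Submaps σ⁻¹ σ⁻¹-injective β β-involutive public

  -- ⌊_⌋ rather than does, so that countF isLeg is numLegs by definition
  isLeg : Fin n → Bool
  isLeg h = ⌊ opp h ≟ h ⌋

  edges : Fin n → Bool
  edges = (λ _ → true) ∖ isLeg

  tree : Fin n → Bool
  tree h = does (T? h)

  join : (Fin n → Bool) → Fin n → Bool
  join S = insert g (insert f S)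

  join-f : ∀ S → join S f ≡ true
  join-f S = trans (insert-≢ (insert f S) f≢g) (insert-≡ f S)

  join-g : ∀ S → join S g ≡ true
  join-g S = insert-≡ g (insert f S)

  join-other : ∀ S {h} → h ≢ f → h ≢ g → join S h ≡ S h
  join-other S h≢f h≢g = trans (insert-≢ (insert f S) h≢g) (insert-≢ S h≢f)

  countF-join : ∀ {S} → S f ≡ false → S g ≡ false → countF (join S) ≡ 2 + countF S
  countF-join {S} Sf Sg =
    trans (countF-insert g (trans (insert-≢ S (f≢g ∘ sym)) Sg)) (cong suc (countF-insert f Sf))

  closed-from-opp : ∀ {S} → S f ≡ S g → (∀ h → h ≢ f → h ≢ g → S (opp h) ≡ S h) → Closed S
  closed-from-opp {S} Sf≡Sg S-opp h = by-cases (h ≟ f) (h ≟ g)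
    where
    by-cases : Dec (h ≡ f) → Dec (h ≡ g) → S (β h) ≡ S h
    by-cases (yes refl) _          = trans (cong S β-f) (sym Sf≡Sg)
    by-cases (no _)     (yes refl) = trans (cong S β-g) Sf≡Sg
    by-cases (no h≢f)   (no h≢g)   = trans (cong S (β-other h≢f h≢g)) (S-opp h h≢f h≢g)

  join-closed : ∀ {S} → (∀ h → h ≢ f → h ≢ g → S (opp h) ≡ S h) → Closed (join S)
  join-closed {S} S-opp = closed-from-opp (trans (join-f S) (sym (join-g S))) λ h h≢f h≢g →
    trans (join-other S (h≢f ∘ opp-fixed f-leg) (h≢g ∘ opp-fixed g-leg))
          (trans (S-opp h h≢f h≢g) (sym (join-other S h≢f h≢g)))

  tree-true : ∀ {h} → tree h ≡ true → T h
  tree-true {h} eq = invert (subst (Reflects (T h)) eq (proof (T? h)))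

  tree-false : ∀ {h} → Leg h → tree h ≡ false
  tree-false {h} h-leg = dec-false (T? h) λ Th → T-notLeg h Th h-leg

  tree-opp : ∀ h → tree (opp h) ≡ tree h
  tree-opp h with T? h | T? (opp h)
  ... | yes _  | yes _   = refl
  ... | no _   | no _    = refl
  ... | yes Th | no ¬Th′ = contradiction (T-sym h Th) ¬Th′
  ... | no ¬Th | yes Th′ = contradiction (subst T (α-invol h) (T-sym (opp h) Th′)) ¬Th

  isLeg-opp : ∀ h → isLeg (opp h) ≡ isLeg h
  isLeg-opp h with opp h ≟ h | opp (opp h) ≟ opp h
  ... | yes _   | yes _   = refl
  ... | no _    | no _    = refl
  ... | yes eq  | no neq  = contradiction (cong opp eq) neq
  ... | no neq  | yes eq  = contradiction (opp-injective eq) neq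

  edges-leg : ∀ {h} → Leg h → edges h ≡ false
  edges-leg {h} h-leg = cong not (trans (isYes≗does (opp h ≟ h)) (dec-true (opp h ≟ h) h-leg))

  edges-edge : ∀ {h} → NotLeg h → edges h ≡ true
  edges-edge {h} h-edge = cong not (trans (isYes≗does (opp h ≟ h)) (dec-false (opp h ≟ h) h-edge))

  tree-closed : Closed tree
  tree-closed = closed-from-opp (trans (tree-false f-leg) (sym (tree-false g-leg))) λ h _ _ → tree-opp h

  join-tree-closed : Closed (join tree)
  join-tree-closed = join-closed λ h _ _ → tree-opp h

  join-edges-closed : Closed (join edges)
  join-edges-closed = join-closed λ h _ _ → cong not (isLeg-opp h)

  module Vertex = Cycles σ⁻¹ σ⁻¹-injective
  module Face   = Cycles φ φ-injective

  σ-iterate⇒↝ : ∀ k {x y} → iter (σ ⟨$⟩ʳ_) k y ≡ x → x Vertex.↝ y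
  σ-iterate⇒↝ zero    refl = Vertex.↝-refl
  σ-iterate⇒↝ (suc k) refl = Vertex.↝-trans (1 , inverseˡ σ) (σ-iterate⇒↝ k refl)

  same-vertex⇒↝ : ∀ {x y} → vert x ≡ vert y → x Vertex.↝ y
  same-vertex⇒↝ {x} {y} eq with k , σᵏy≡x ← vert-orbit y x (sym eq) = σ-iterate⇒↝ k σᵏy≡x

  ↝⇒same-vertex : ∀ {x y} → x Vertex.↝ y → vert x ≡ vert y
  ↝⇒same-vertex (zero  , refl) = refl
  ↝⇒same-vertex (suc k , refl) = trans (↝⇒same-vertex (k , refl)) (sym (vert-σ⁻¹ _))

  faces-without-edges : faces (λ _ → false) ≡ V
  faces-without-edges = Vertex.cycles-≡ vert same-vertex⇒↝ ↝⇒same-vertex vert-surj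

  join-edges-transposition : Transposition φ (ψ (join edges)) f g
  join-edges-transposition = record
    { at-a      = cong σ⁻¹ (trans (β-on-true (join edges) (join-f edges)) (trans β-f (sym g-leg)))
    ; at-b      = cong σ⁻¹ (trans (β-on-true (join edges) (join-g edges)) (trans β-g (sym f-leg)))
    ; elsewhere = λ h h≢f h≢g → cong σ⁻¹ (trans (cong (λ b → if b then β h else h) (join-other edges h≢f h≢g))
                                               (by-cases h≢f h≢g (opp h ≟ h)))
    }
    where
    by-cases : ∀ {h} → h ≢ f → h ≢ g → Dec (opp h ≡ h) → β-on edges h ≡ opp h
    by-cases _   _   (yes h-leg)  = trans (β-on-false edges (edges-leg h-leg)) (sym h-leg)
    by-cases h≢f h≢g (no h-edge) = trans (β-on-true edges (edges-edge h-edge)) (β-other h≢f h≢g)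

  faces-join-edges : faces (join edges) ≡ suc F
  faces-join-edges =
    trans (TranspositionCycles.cycles-split φ-injective (ψ-injective join-edges-closed) f≢g join-edges-transposition
            (face-orbit f g (trans (legs-in-head-face f f-leg) (sym (legs-in-head-face g g-leg)))))
          (cong suc (Face.cycles-≡ face (λ {x} {y} → face-orbit x y) (λ {x} {y} (k , eq) → orbit-face x y k eq)
                                   face-surj))

  join-tree-transposition : Transposition (ψ (join tree)) (ψ tree) f g
  join-tree-transposition = record
    { at-a      = cong σ⁻¹ (trans (β-on-false tree (tree-false f-leg))
                                  (sym (trans (β-on-true (join tree) (join-g tree)) β-g)))
    ; at-b      = cong σ⁻¹ (trans (β-on-false tree (tree-false g-leg))
                                  (sym (trans (β-on-true (join tree) (join-f tree)) β-f)))
    ; elsewhere = λ h h≢f h≢g → cong (λ b → σ⁻¹ (if b then β h else h)) (sym (join-other tree h≢f h≢g))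
    }

  module Tree = Cycles (ψ tree) (ψ-injective tree-closed)

  tree-half-edge : ∀ {h} → tree h ≡ true → h ≢ f × h ≢ g
  tree-half-edge Th = (λ { refl → T-notLeg f (tree-true Th) f-leg }) ,
                      (λ { refl → T-notLeg g (tree-true Th) g-leg })

  β-on-tree : ∀ {h} → tree h ≡ true → β-on tree h ≡ opp h
  β-on-tree Th = trans (β-on-true tree Th) (β-other (proj₁ (tree-half-edge Th)) (proj₂ (tree-half-edge Th)))

  tree-step : ∀ d y → y ≢ d → y ≢ opp d → Connected (T-without d) (vert y) (vert (ψ tree y))
  tree-step d y y≢d y≢d′ with tree y in Ty
  ... | true with y≢f , y≢g ← tree-half-edge Ty =
    _ , cons (tree-true Ty , y≢d , y≢d′) (T-notLeg y (tree-true Ty)) refl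
             (subst (Walk (T-without d) (vert (opp y)) [])
                    (sym (trans (vert-σ⁻¹ _) (cong vert (β-other y≢f y≢g)))) nil)
  ... | false = _ , subst (Walk (T-without d) (vert y) []) (sym (vert-σ⁻¹ y)) nil

  -- The face of the tree runs from ψ d, at the vertex of opp d, back to d; it must cross the edge of d.
  tree-reaches-opp : ∀ {x d} → T d → x Tree.↝ d → x Tree.↝ opp d
  tree-reaches-opp {x} {d} Td x↝d with Tree.first-return d
  ... | p , back , before-p = cross (orbit-crosses (ψ tree) d (tree-step d) p (ψ tree d) apart)
    where
    apart : ¬ Connected (T-without d) (vert (ψ tree d)) (vert (iter (ψ tree) p (ψ tree d)))
    apart = tree-bridge Td ∘ subst₂ (Connected (T-without d))
              (trans (vert-σ⁻¹ _) (cong vert (β-on-tree (dec-true (T? d) Td))))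
              (cong vert (trans (sym (iter-suc (ψ tree) p d)) back))
    cross : (∃ λ i → i < p × (iter (ψ tree) i (ψ tree d) ≡ d ⊎ iter (ψ tree) i (ψ tree d) ≡ opp d)) →
            x Tree.↝ opp d
    cross (i , i<p , inj₁ at-d)  = ⊥-elim (before-p i i<p (trans (iter-suc (ψ tree) i d) at-d))
    cross (i , i<p , inj₂ at-d′) = Tree.↝-trans x↝d (suc i , trans (iter-suc (ψ tree) i d) at-d′)

  tree-σ⁻¹ : ∀ {x y} → x Tree.↝ y → x Tree.↝ σ⁻¹ y
  tree-σ⁻¹ {x} {y} x↝y = Tree.↝-trans x↝βy (1 , cong σ⁻¹ (β-on-involutive tree-closed y))
    where
    by-cases : ∀ b → tree y ≡ b → x Tree.↝ β-on tree y
    by-cases true  Ty = subst (x Tree.↝_) (sym (β-on-tree Ty)) (tree-reaches-opp (tree-true Ty) x↝y)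
    by-cases false Ty = subst (x Tree.↝_) (sym (β-on-false tree Ty)) x↝y
    x↝βy : x Tree.↝ β-on tree y
    x↝βy = by-cases (tree y) refl

  tree-same-vertex : ∀ {x y z} → x Tree.↝ y → vert y ≡ vert z → x Tree.↝ z
  tree-same-vertex {x} {y} x↝y eq with same-vertex⇒↝ eq
  ... | k , refl = around k
    where
    around : ∀ k → x Tree.↝ iter σ⁻¹ k y
    around zero    = x↝y
    around (suc k) = tree-σ⁻¹ (around k)

  tree-walk : ∀ {x a hs b} → Walk T a hs b →
              (∀ k → vert k ≡ a → x Tree.↝ k) → ∀ k → vert k ≡ b → x Tree.↝ k
  tree-walk nil                        x↝a = x↝a
  tree-walk (cons {h = h} Th _ h-at w) x↝a =
    tree-walk w λ k k-at → tree-same-vertex (tree-reaches-opp Th (x↝a h h-at)) (sym k-at)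

  tree-reaches-all : ∀ x y → x Tree.↝ y
  tree-reaches-all x y with connected-trans (connected-sym T-sym (T-spans (vert x))) (T-spans (vert y))
  ... | _ , w = tree-walk w (λ k k-at → tree-same-vertex Tree.↝-refl (sym k-at)) y refl

  faces-tree : faces tree ≤ 1
  faces-tree = Tree.cycles-≤1 root (tree-reaches-all root)

  tree⊆edges : ∀ {h} → tree h ≡ true → edges h ≡ true
  tree⊆edges {h} Th = edges-edge (T-notLeg h (tree-true Th))

  join-tree⊆join-edges : ∀ h → join tree h ≡ true → join edges h ≡ true
  join-tree⊆join-edges h = by-cases (h ≟ f) (h ≟ g)
    where
    by-cases : Dec (h ≡ f) → Dec (h ≡ g) → join tree h ≡ true → join edges h ≡ true
    by-cases (yes refl) _          _  = join-f edges
    by-cases (no _)     (yes refl) _  = join-g edges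
    by-cases (no h≢f)   (no h≢g)   Uh =
      trans (join-other edges h≢f h≢g) (tree⊆edges (trans (sym (join-other tree h≢f h≢g)) Uh))

  edge-no-loop : ∀ {h} → h ≢ f → h ≢ g → edges h ≡ true → h ≢ β h
  edge-no-loop {h} h≢f h≢g Eh loop = contradiction (trans (sym Eh) (edges-leg (sym (trans loop (β-other h≢f h≢g)))))
                                                    λ ()

  tree-bounds : FaceBounds {S₀ = λ _ → false} (λ _ → refl) tree
  tree-bounds = face-bounds (λ _ → refl) tree-closed (λ _ ()) no-loop
    where
    no-loop : ∀ h → tree h ≡ true → false ≡ false → h ≢ β h
    no-loop h Th _ = edge-no-loop (proj₁ (tree-half-edge Th)) (proj₂ (tree-half-edge Th)) (tree⊆edges Th)

  join-bounds : FaceBounds join-tree-closed (join edges)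
  join-bounds = face-bounds join-tree-closed join-edges-closed join-tree⊆join-edges no-loop
    where
    by-cases : ∀ {h} → Dec (h ≡ f) → Dec (h ≡ g) →
               join edges h ≡ true → join tree h ≡ false → h ≢ β h
    by-cases (yes refl) _          _  Uh = contradiction (trans (sym (join-f tree)) Uh) λ ()
    by-cases (no _)     (yes refl) _  Uh = contradiction (trans (sym (join-g tree)) Uh) λ ()
    by-cases (no h≢f)   (no h≢g)   Eh _  =
      edge-no-loop h≢f h≢g (trans (sym (join-other edges h≢f h≢g)) Eh)
    no-loop : ∀ h → join edges h ≡ true → join tree h ≡ false → h ≢ β h
    no-loop h = by-cases (h ≟ f) (h ≟ g)

  module Unicycle = Cycles (ψ (join tree)) (ψ-injective join-tree-closed)
  module Joined   = Cycles (ψ (join edges)) (ψ-injective join-edges-closed)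

  private
    new : ℕ
    new = countF (join edges ∖ join tree)

  countF-new-edges : new + countF tree + numLegs ≡ n
  countF-new-edges = begin
    new + countF tree + numLegs ≡⟨ cong (_+ numLegs) new+tree ⟩
    countF edges + numLegs      ≡⟨ countF-∖ {q = isLeg} (λ _ _ → refl) ⟩
    countF {n} (λ _ → true)     ≡⟨ countF-true n ⟩
    n                           ∎
    where
    open ≡-Reasoning
    new+tree : new + countF tree ≡ countF edges
    new+tree = +-cancelˡ-≡ 2 _ _ (begin
      2 + (new + countF tree)  ≡⟨ sym (+-2+ new (countF tree)) ⟩
      new + (2 + countF tree)  ≡⟨ cong (new +_) (sym (countF-join (tree-false f-leg) (tree-false g-leg))) ⟩
      new + countF (join tree) ≡⟨ countF-∖ join-tree⊆join-edges ⟩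
      countF (join edges)      ≡⟨ countF-join (edges-leg f-leg) (edges-leg g-leg) ⟩
      2 + countF edges         ∎)

  new-edges-slack : new + 2 ≤ 2 * F
  new-edges-slack = euler-slack {V} {F} tree-bound planar countF-new-edges
    where
    open FaceBounds tree-bounds
    tree-bound : 2 * V ≤ 2 + countF tree
    tree-bound = begin
      2 * V                                        ≡⟨ cong (2 *_) (sym faces-without-edges) ⟩
      2 * faces (λ _ → false)                      ≤⟨ lower ⟩
      2 * faces tree + countF (tree ∖ λ _ → false) ≡⟨ cong (2 * faces tree +_) (countF-cong λ h → ∧-identityʳ (tree h)) ⟩
      2 * faces tree + countF tree                 ≤⟨ +-monoˡ-≤ (countF tree) (*-monoʳ-≤ 2 faces-tree) ⟩
      2 + countF tree                              ∎
      where open ≤-Reasoning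

  joined-upper : 2 * suc F ≤ 2 * faces (join tree) + new
  joined-upper = subst (λ c → 2 * c ≤ 2 * faces (join tree) + new) faces-join-edges (FaceBounds.upper join-bounds)

  unicycle-separates : ¬ f Unicycle.↝ g
  unicycle-separates f↝g = <-irrefl refl (begin-strict
    2 * suc F                      ≤⟨ joined-upper ⟩
    2 * faces (join tree) + new    ≡⟨ cong (λ c → 2 * c + new) no-faces ⟩
    new                            ≤⟨ m≤m+n new 2 ⟩
    new + 2                        ≤⟨ new-edges-slack ⟩
    2 * F                          <⟨ *-monoʳ-< 2 (n<1+n F) ⟩
    2 * suc F                      ∎)
    where
    open ≤-Reasoning
    split : faces tree ≡ suc (faces (join tree))
    split = TranspositionCycles.cycles-split (ψ-injective join-tree-closed) (ψ-injective tree-closed) f≢g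
              join-tree-transposition f↝g
    no-faces : faces (join tree) ≡ 0
    no-faces = n≤0⇒n≡0 (s≤s⁻¹ (subst (_≤ 1) split faces-tree))

  -- Euler's formula leaves no room: every edge outside the unicycle splits a face.
  joined-refines : ∀ {x y} → x Joined.↝ y → x Unicycle.↝ y
  joined-refines = FaceBounds.tight⇒coarser join-bounds (≤-antisym (FaceBounds.upper join-bounds) (begin
    2 * faces (join tree) + new    ≡⟨ cong (λ c → 2 * c + new) merge ⟩
    2 * suc (faces tree) + new     ≤⟨ +-monoˡ-≤ new (*-monoʳ-≤ 2 (s≤s faces-tree)) ⟩
    4 + new                        ≡⟨ trans (+-comm 4 new) (sym (+-assoc new 2 2)) ⟩
    new + 2 + 2                    ≤⟨ +-monoˡ-≤ 2 new-edges-slack ⟩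
    2 * F + 2                      ≡⟨ trans (+-comm (2 * F) 2) (sym (*-suc 2 F)) ⟩
    2 * suc F                      ≡⟨ cong (2 *_) (sym faces-join-edges) ⟩
    2 * faces (join edges)         ∎))
    where
    open ≤-Reasoning
    merge : faces (join tree) ≡ suc (faces tree)
    merge = cycles-merge (ψ-injective join-tree-closed) (ψ-injective tree-closed) f≢g join-tree-transposition
              unicycle-separates

  joined-agrees : ∀ m x → (∀ r → r < m → iter φ r x ≢ f × iter φ r x ≢ g) →
                  iter (ψ (join edges)) m x ≡ iter φ m x
  joined-agrees = transposition-agrees join-edges-transposition

  head-reaches-f : ∀ {i₁ i₂} → head ≢ f → head ≢ g → TourIndex f i₁ → TourIndex g i₂ → i₁ < i₂ →
                   head Joined.↝ f
  head-reaches-f {i₁} head≢f head≢g (_ , f-at , f-first) (_ , _ , g-first) i₁<i₂ =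
    i₁ , trans (joined-agrees i₁ head avoid) f-at
    where
    avoid : ∀ r → r < i₁ → iter φ r head ≢ f × iter φ r head ≢ g
    avoid zero    _    = head≢f , head≢g
    avoid (suc r) r<i₁ = f-first (suc r) (s≤s z≤n) r<i₁ , g-first (suc r) (s≤s z≤n) (<-trans r<i₁ i₁<i₂)

  tour-no-return : ∀ {l j} → TourIndex l j → ∀ δ → 0 < δ → δ < j → iter φ δ head ≢ head
  tour-no-return {l} {j} (_ , l-at , l-first) δ 0<δ δ<j back =
    l-first (j ∸ δ) (m<n⇒0<n∸m δ<j) (∸-monoʳ-< 0<δ (<⇒≤ δ<j)) (begin
      iter φ (j ∸ δ) head            ≡⟨ cong (iter φ (j ∸ δ)) (sym back) ⟩
      iter φ (j ∸ δ) (iter φ δ head) ≡⟨ sym (iter-+ φ (j ∸ δ) δ head) ⟩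
      iter φ (j ∸ δ + δ) head        ≡⟨ cong (λ k → iter φ k head) (m∸n+n≡m (<⇒≤ δ<j)) ⟩
      iter φ j head                  ≡⟨ l-at ⟩
      l                              ∎)
    where open ≡-Reasoning

  -- The joined edge sends g to where f led; from there the tour reaches l before meeting f or g again.
  g-reaches-l : ∀ {l i₁ j i₂} → TourIndex f i₁ → TourIndex l j → TourIndex g i₂ → i₁ < j → j < i₂ →
                g Joined.↝ l
  g-reaches-l {l} {i₁} {j} {i₂} (_ , f-at , _) l-tour@(_ , l-at , _) (_ , _ , g-first) i₁<j j<i₂ = suc m , (begin
    iter (ψ (join edges)) (suc m) g            ≡⟨ iter-suc (ψ (join edges)) m g ⟩
    iter (ψ (join edges)) m (ψ (join edges) g) ≡⟨ cong (iter (ψ (join edges)) m)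
                                                       (Transposition.at-b join-edges-transposition) ⟩
    iter (ψ (join edges)) m (φ f)              ≡⟨ joined-agrees m (φ f) avoid ⟩
    iter φ m (φ f)                             ≡⟨ position m ⟩
    iter φ (m + suc i₁) head                   ≡⟨ cong (λ k → iter φ k head) (m∸n+n≡m i₁<j) ⟩
    iter φ j head                              ≡⟨ l-at ⟩
    l                                          ∎)
    where
    open ≡-Reasoning
    m : ℕ
    m = j ∸ suc i₁
    position : ∀ r → iter φ r (φ f) ≡ iter φ (r + suc i₁) head
    position r = trans (cong (iter φ r ∘ φ) (sym f-at)) (sym (iter-+ φ r (suc i₁) head))
    avoid : ∀ r → r < m → iter φ r (φ f) ≢ f × iter φ r (φ f) ≢ g
    avoid r r<m = f-no-return , g-later
      where
      before-j : r + suc i₁ < j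
      before-j = subst (r + suc i₁ <_) (m∸n+n≡m i₁<j) (+-monoˡ-< (suc i₁) r<m)
      g-later : iter φ r (φ f) ≢ g
      g-later eq = g-first (r + suc i₁) (≤-trans (s≤s z≤n) (m≤n+m (suc i₁) r)) (<-trans before-j j<i₂)
                           (trans (sym (position r)) eq)
      f-no-return : iter φ r (φ f) ≢ f
      f-no-return eq =
        tour-no-return l-tour (suc r) (s≤s z≤n)
                       (≤-<-trans (s≤s (m≤m+n r i₁)) (subst (_< j) (+-suc r i₁) before-j))
          (Face.iter-injective i₁ (begin
            iter φ i₁ (iter φ (suc r) head) ≡⟨ iter-comm φ i₁ (suc r) head ⟩
            iter φ (suc r) (iter φ i₁ head) ≡⟨ cong (iter φ (suc r)) f-at ⟩
            iter φ (suc r) f                ≡⟨ iter-suc φ r f ⟩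
            iter φ r (φ f)                  ≡⟨ eq ⟩
            f                               ≡⟨ sym f-at ⟩
            iter φ i₁ head                  ∎))

  module _ {u v l} (sep : Separation u v (vert head) (vert l))
           (endpoints : (u ≡ vert f × v ≡ vert g) ⊎ (u ≡ vert g × v ≡ vert f)) where

    open Separation sep renaming (edge to d)

    private
      f-inside : vert f ≡ u ⊎ vert f ≡ v
      f-inside = [ (λ (eu , _) → inj₁ (sym eu)) , (λ (_ , ev) → inj₂ (sym ev)) ]′ endpoints
      g-inside : vert g ≡ u ⊎ vert g ≡ v
      g-inside = [ (λ (_ , ev) → inj₂ (sym ev)) , (λ (eu , _) → inj₁ (sym eu)) ]′ endpoints
      f~g : Connected (T-without d) (vert f) (vert g)
      f~g = [ (λ (eu , ev) → subst₂ (Connected _) eu ev inner)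
            , (λ (eu , ev) → connected-sym (T-without-sym d) (subst₂ (Connected _) eu ev inner))
            ]′ endpoints

      unicycle-step : ∀ y → y ≢ d → y ≢ opp d → Connected (T-without d) (vert y) (vert (ψ (join tree) y))
      unicycle-step y y≢d y≢d′ = by-cases (y ≟ f) (y ≟ g)
        where
        by-cases : Dec (y ≡ f) → Dec (y ≡ g) → Connected (T-without d) (vert y) (vert (ψ (join tree) y))
        by-cases (yes refl) _          = subst (Connected _ (vert f))
          (sym (trans (vert-σ⁻¹ _) (cong vert (trans (β-on-true (join tree) (join-f tree)) β-f)))) f~g
        by-cases (no _)     (yes refl) = subst (Connected _ (vert g))
          (sym (trans (vert-σ⁻¹ _) (cong vert (trans (β-on-true (join tree) (join-g tree)) β-g))))
          (connected-sym (T-without-sym d) f~g)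
        by-cases (no y≢f)   (no y≢g)   = subst (Connected _ (vert y))
          (cong vert (Transposition.elsewhere join-tree-transposition y y≢f y≢g))
          (tree-step d y y≢d y≢d′)

      crosses : ∀ {x y} k → iter (ψ (join tree)) k x ≡ y → ¬ Connected (T-without d) (vert x) (vert y) →
                ∃ λ i → i < k × (iter (ψ (join tree)) i x ≡ d ⊎ iter (ψ (join tree)) i x ≡ opp d)
      crosses k refl = orbit-crosses (ψ (join tree)) d unicycle-step k _

    -- The arcs head → f and f → head of one unicycle face both cross the edge of d, so between them
    -- they pass d and opp d; the face of g crosses it as well, hence it is the face of f.
    unicycle-crossing : head Unicycle.↝ f → g Unicycle.↝ l → ⊥
    unicycle-crossing head↝f (k , at-l)
      with Unicycle.first-arrival head↝f | Unicycle.first-arrival (Unicycle.↝-sym head↝f)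
    ... | a , at-f , before-f | b , at-head , before-head
      with crosses a at-f (separated (inj₁ refl) f-inside)
         | crosses b at-head (separated (inj₁ refl) f-inside ∘ connected-sym (T-without-sym d))
         | crosses k at-l (separated (inj₂ refl) g-inside ∘ connected-sym (T-without-sym d))
    ... | i₁ , i₁<a , c₁ | i₂ , i₂<b , c₂ | i₃ , _ , c₃ =
      unicycle-separates (Unicycle.↝-trans f↝y₃ (Unicycle.↝-sym (i₃ , refl)))
      where
      f↝y₃ : f Unicycle.↝ iter (ψ (join tree)) i₃ g
      f↝y₃ with pigeonhole-2 c₁ c₂ c₃ (Unicycle.arcs-disjoint before-f before-head i₁<a i₂<b)
      ... | inj₁ eq = subst (f Unicycle.↝_) (sym eq) (Unicycle.↝-trans (b , at-head) (i₁ , refl))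
      ... | inj₂ eq = subst (f Unicycle.↝_) (sym eq) (i₂ , refl)

  tour-index : ∀ {l} → Leg l → l ≢ head → ∃ λ j → TourIndex l j
  tour-index {l} l-leg l≢head with Face.first-arrival (face-orbit head l (sym (legs-in-head-face l l-leg)))
  ... | zero  , at-l , _      = contradiction (sym at-l) l≢head
  ... | suc j , at-l , before = suc j , s≤s z≤n , at-l , λ m _ m<j → before m m<j

  tour-index-injective : ∀ {l l′ i} → TourIndex l i → TourIndex l′ i → l ≡ l′
  tour-index-injective (_ , at-l , _) (_ , at-l′ , _) = trans (sym at-l) at-l′

  no-leg-between : ∀ {u v l} → IsFirstLeg f → IsLastLeg g → OtherLeg l → l ≢ f → l ≢ g →
                   Separation u v (vert head) (vert l) →
                   (u ≡ vert f × v ≡ vert g) ⊎ (u ≡ vert g × v ≡ vert f) → ⊥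
  no-leg-between ((_ , f≢head) , i₁ , f-tour , f-first) ((_ , g≢head) , i₂ , g-tour , g-last) l-other l≢f l≢g
                 sep endpoints with tour-index (proj₁ l-other) (proj₂ l-other)
  ... | j , l-tour = unicycle-crossing sep endpoints
    (joined-refines (head-reaches-f (f≢head ∘ sym) (g≢head ∘ sym) f-tour g-tour (<-trans i₁<j j<i₂)))
    (joined-refines (g-reaches-l f-tour l-tour g-tour i₁<j j<i₂))
    where
    i₁<j : i₁ < j
    i₁<j = ≤∧≢⇒< (f-first _ j l-other l-tour) λ { refl → l≢f (tour-index-injective l-tour f-tour) }
    j<i₂ : j < i₂
    j<i₂ = ≤∧≢⇒< (g-last _ j l-other l-tour) λ { refl → l≢g (tour-index-injective l-tour g-tour) }

¬¬-decidable : ∀ {n} (P : Fin n → Set) → ¬ ¬ (∀ h → Dec (P h))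
¬¬-decidable {zero}  P undecidable = undecidable λ ()
¬¬-decidable {suc n} P undecidable = ¬¬-excluded-middle λ P₀? → ¬¬-decidable (P ∘ suc) λ P₊? →
  undecidable λ { zero → P₀? ; (suc h) → P₊? h }

mainTheorem6 : (M : TreeGrowingMap) →
    let open TreeGrowingMap M in
    (∀ l → Leg l → Ancestor (vert l) headVertex) →
    (f g : Fin n) → IsFirstLeg f → IsLastLeg g → vert f ≢ vert g →
    (u v : Fin V) →
    ((u ≡ vert f × v ≡ vert g) ⊎ (u ≡ vert g × v ≡ vert f)) →
    Ancestor u v →
    Ancestor v headVertex ×
    Σ (Fin n) (λ l → OtherLeg l × vert l ≡ v) ×
    (∀ l → OtherLeg l → Ancestor (vert l) v)
mainTheorem6 M legs-above-head f g first last vf≢vg u v endpoints u-above-v@(qs , wq , uq , u∈qs) =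
  v-above-head , leg-at-v , legs-above-v
  where
  open TreeGrowingMap M
  open TreeProperties M
  open import Data.List.Membership.DecPropositional (_≟_ {V}) using (_∈?_)

  leg-at-v : Σ (Fin n) (λ l → OtherLeg l × vert l ≡ v)
  leg-at-v = [ (λ (_ , ev) → g , proj₁ last , sym ev) , (λ (_ , ev) → f , proj₁ first , sym ev) ]′ endpoints

  v-above-head : Ancestor v headVertex
  v-above-head with l , (l-leg , _) , at-v ← leg-at-v =
    subst (λ x → Ancestor x headVertex) at-v (legs-above-head l l-leg)

  f∈qs : vert f ∈ visited rootVertex qs
  f∈qs = [ (λ (eu , _) → subst (_∈ _) eu u∈qs) , (λ (_ , ev) → subst (_∈ _) ev (end∈visited wq)) ]′ endpoints

  g∈qs : vert g ∈ visited rootVertex qs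
  g∈qs = [ (λ (_ , ev) → subst (_∈ _) ev (end∈visited wq)) , (λ (eu , _) → subst (_∈ _) eu u∈qs) ]′ endpoints

  -- T is not assumed decidable, but in the remaining case the goal is ⊥, so deciding T costs nothing.
  legs-above-v : ∀ l → OtherLeg l → Ancestor (vert l) v
  legs-above-v l l-other with vert l ∈? visited rootVertex qs
  ... | yes l∈qs = qs , wq , uq , l∈qs
  ... | no  l∉qs = ⊥-elim (¬¬-decidable T λ T? →
    JoinedLegs.no-leg-between M T? (proj₁ (proj₁ first)) (proj₁ (proj₁ last)) (vf≢vg ∘ cong vert)
      first last l-other (λ { refl → l∉qs f∈qs }) (λ { refl → l∉qs g∈qs })
      (ancestor-separation u-above-v v-above-head (legs-above-head l (proj₁ l-other)) l∉qs) endpoints)
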